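{- Let $C$ be a doubly even self-dual binary linear code of length $N$ with code-lattice $L$, and let $\bar g\in\operatorname{Aut}C$ have cycle type $2^{N/2}$. Suppose the fixed subcode $C^{\bar g}$ has dimension $\frac12\dim C+1=\frac N4+1$ and is spanned by codewords $B_0,B_1,\dots,B_{N/4}$ (viewed as subsets of $\{1,\dots,N\}$) such that (1) $|B_0|=N/2$; (2) $|B_j|=4$ for $1\le j\le N/4$; (3) $B_i\cap B_j=\emptyset$ for $1\le i,j\le N/4$, $i\ne j$; (4) $|B_0\cap B_j|=2$ for $1\le j\le N/4$. Then the sublattice fixed by $g=\iota(\bar g)$ has theta series $\theta_{L^g}(q)=\vartheta_3(q^2)^{N/2}+\vartheta_2(q^2)^{N/2}$. In particular its theta series agrees with that of $D_{N/2}^*(2)$.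
   Context: Code-lattice: $\langle\beta_i,\beta_j\rangle=\tfrac12\delta_{ij}$, $L=\{\sum_ia_i\beta_i:a_i\in\mathbb{Z},(a_i\bmod2)_i\in C\}$; $\iota(\sigma)(\beta_j)=\beta_{\sigma(j)}$; $L^g$ the fixed sublattice; $\theta_M(q)=\sum_{\lambda\in M}q^{\langle\lambda,\lambda\rangle/2}$. $C^{\bar g}=\{c\in C:\bar gc=c\}$. $\vartheta_2(q)=\sum_nq^{(n+\frac12)^2/2}$, $\vartheta_3(q)=\sum_nq^{n^2/2}$. $D_n=\{x\in\mathbb{Z}^n:\sum x_i\text{ even}\}$, $D_n^*$ its dual, $M(2)$ is $M$ with form doubled. -}

module Defs where

open import Data.Bool using (Bool; true; false; _∧_; _∨_; _xor_; if_then_else_; not)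
open import Data.Nat using (ℕ; zero; suc; _+_; _*_; _%_; _≡ᵇ_)
open import Data.Integer as ℤ using (ℤ; +_; -[1+_]; ∣_∣)
open import Data.Fin using (Fin; zero; suc)
open import Data.Fin.Permutation using (Permutation′; _⟨$⟩ʳ_; _⟨$⟩ˡ_)
open import Data.Vec as Vec using (Vec; []; _∷_; lookup; tabulate; zipWith; replicate; foldr)
import Data.Vec.Properties as VecP
open import Data.List as List using (List; length; filterᵇ; upTo; concatMap; _++_)
open import Relation.Nullary.Decidable using (⌊_⌋)
open import Relation.Binary.PropositionalEquality using (_≡_; _≢_)
open import Data.Product using (Σ; _×_)

-- Binary words of length N (elements of F₂^N, equivalently subsets of
-- {1..N}); F₂ is Bool with xor as addition and ∧ as multiplication.

Word : ℕ → Set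
Word N = Vec Bool N

zeroWord : ∀ {N} → Word N
zeroWord {N} = replicate N false

_⊕_ : ∀ {N} → Word N → Word N → Word N
_⊕_ = zipWith _xor_

_∩_ : ∀ {N} → Word N → Word N → Word N
_∩_ = zipWith _∧_

weight : ∀ {N} → Word N → ℕ
weight = Vec.countᵇ (λ b → b)

dot : ∀ {N} → Word N → Word N → Bool
dot u v = foldr (λ _ → Bool) _xor_ false (zipWith _∧_ u v)

lincomb : ∀ {N k} → Vec Bool k → (Fin k → Word N) → Word N
lincomb [] B = zeroWord
lincomb (b ∷ s) B = (if b then B zero else zeroWord) ⊕ lincomb s (λ i → B (suc i))

Code : ℕ → Set
Code N = Word N → Bool

_∈C_ : ∀ {N} → Word N → Code N → Set
v ∈C C = C v ≡ true

record IsLinear {N} (C : Code N) : Set where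
  field
    zero∈ : zeroWord ∈C C
    ⊕∈    : ∀ u v → u ∈C C → v ∈C C → (u ⊕ v) ∈C C

record IsSelfDual {N} (C : Code N) : Set where
  field
    sub  : ∀ v → v ∈C C → ∀ c → c ∈C C → dot v c ≡ false
    sup  : ∀ v → (∀ c → c ∈C C → dot v c ≡ false) → v ∈C C

IsDoublyEven : ∀ {N} → Code N → Set
IsDoublyEven C = ∀ c → c ∈C C → weight c % 4 ≡ 0

-- For σ ∈ Sym(N), the action on vectors
-- sends e_j to e_{σ(j)}, i.e. (σ·v)_i = v_{σ⁻¹(i)}.  This is both the
-- action of Aut C on codewords and ι(σ) on L (ι(σ)(β_j) = β_{σ(j)}).

act : ∀ {A : Set} {N} → Permutation′ N → Vec A N → Vec A N
act σ v = tabulate (λ i → lookup v (σ ⟨$⟩ˡ i))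

IsAut : ∀ {N} → Code N → Permutation′ N → Set
IsAut C σ = ∀ c → c ∈C C → act σ c ∈C C

-- cycle type 2^{N/2}: a fixed-point-free involution
HasCycleType2 : ∀ {N} → Permutation′ N → Set
HasCycleType2 σ = ∀ i → (σ ⟨$⟩ʳ (σ ⟨$⟩ʳ i) ≡ i) × (σ ⟨$⟩ʳ i ≢ i)

-- All lattices below live in (½ℤ)-coordinates with
-- norms ⟨λ,λ⟩/2 in ¼ℕ, so a theta series is recorded by its sequence of
-- coefficients: thetaCoeff … m = coefficient of q^{m/4}, i.e. the number
-- of lattice vectors λ with 4·(⟨λ,λ⟩/2) = m.  A lattice is presented by
-- integer coordinate vectors y ∈ ℤ^n, a Boolean membership test, and the
-- function Q(y) = 4·(⟨λ,λ⟩/2) ∈ ℕ.  Every vector with Q(y) = m has all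
-- |yᵢ| ≤ m (in all uses below), so enumerating the box [-m,m]^n counts
-- the whole norm shell.

range : ℕ → List ℤ
range m = List.map +_ (upTo (suc m)) ++ List.map -[1+_] (upTo m)

box : (n : ℕ) → ℕ → List (Vec ℤ n)
box zero    m = [] List.∷ List.[]
box (suc n) m = concatMap (λ z → List.map (z ∷_) (box n m)) (range m)

thetaCoeff : (n : ℕ) → (Vec ℤ n → Bool) → (Vec ℤ n → ℕ) → ℕ → ℕ
thetaCoeff n mem Q m = length (filterᵇ (λ y → mem y ∧ (Q y ≡ᵇ m)) (box n m))

sq : ℤ → ℕ
sq z = ∣ z ∣ * ∣ z ∣

sumSq : ∀ {n} → Vec ℤ n → ℕ
sumSq = foldr (λ _ → ℕ) (λ z r → sq z + r) 0

isOdd : ℤ → Bool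
isOdd z = ∣ z ∣ % 2 ≡ᵇ 1

-- Code lattice L: λ = Σ aᵢ βᵢ with ⟨βᵢ,βⱼ⟩ = ½δᵢⱼ, (aᵢ mod 2) ∈ C.
-- ⟨λ,λ⟩/2 = Σ aᵢ²/4, so Q(a) = Σ aᵢ².
-- L^g: those λ with ι(σ)λ = λ, i.e. act σ a = a.
vecEqᵇ : ∀ {n} → Vec ℤ n → Vec ℤ n → Bool
vecEqᵇ u v = ⌊ VecP.≡-dec ℤ._≟_ u v ⌋

θ-Lg : ∀ {N} → Code N → Permutation′ N → ℕ → ℕ
θ-Lg {N} C σ = thetaCoeff N (λ a → C (Vec.map isOdd a) ∧ vecEqᵇ (act σ a) a) sumSq

-- ϑ₃(q²)^n = Σ_{x ∈ ℤ^n} q^{Σ xᵢ²}: coefficient of q^{m/4} counts x with 4Σxᵢ² = m.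
θ3q2pow : ℕ → ℕ → ℕ
θ3q2pow n = thetaCoeff n (λ _ → true) (λ x → 4 * sumSq x)

-- ϑ₂(q²)^n = Σ_{x ∈ ℤ^n} q^{Σ (xᵢ+½)²}: counts x with Σ(2xᵢ+1)² = m.
twoXplus1 : ℤ → ℤ
twoXplus1 x = (+ 2) ℤ.* x ℤ.+ (+ 1)

θ2q2pow : ℕ → ℕ → ℕ
θ2q2pow n = thetaCoeff n (λ _ → true) (λ x → sumSq (Vec.map twoXplus1 x))

-- D_n^*(2): D_n^* = ℤ^n ∪ (ℤ^n + (½,…,½)); a point x is encoded by y = 2x ∈ ℤ^n
-- (all yᵢ even, or all yᵢ odd).  In M(2), ⟨x,x⟩' = 2 x·x, so
-- ⟨x,x⟩'/2 = x·x = Σ yᵢ²/4 and Q(y) = Σ yᵢ².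
allᵇ : ∀ {n} → (ℤ → Bool) → Vec ℤ n → Bool
allᵇ p = foldr (λ _ → Bool) (λ z r → p z ∧ r) true

θ-Dstar2 : ℕ → ℕ → ℕ
θ-Dstar2 n = thetaCoeff n (λ y → allᵇ (λ z → not (isOdd z)) y ∨ allᵇ isOdd y) sumSq

module Submission where

-- Write k = N/4 and B₁, …, B_k for the weight-4 blocks.  Since ḡ is a fixed-point-free involution
-- fixing every Bⱼ, each block splits into the ḡ-orbits {pⱼ, ḡpⱼ} = B₀ ∩ Bⱼ and {qⱼ, ḡqⱼ} = Bⱼ ∖ B₀,
-- and expanding the all-ones word of C^ḡ in the basis B₀, …, B_k shows that the blocks cover all
-- N = 4k coordinates.  Hence a g-fixed vector of L is determined by its values uⱼ at pⱼ and vⱼ at qⱼ,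
-- its norm is 2(|u|² + |v|²), and its reduction mod 2 lies in C^ḡ exactly when all uⱼ + vⱼ have the
-- same parity.  The rotation (u, v) ↦ (u + v, u − v) maps these vectors isometrically onto the
-- vectors of ℤ^{2k} whose coordinates are all even or all odd, which is D*_{N/2}(2) in the
-- coordinates y = 2x; its all-even and all-odd parts contribute ϑ₃(q²)^{N/2} and ϑ₂(q²)^{N/2}.

open import Defs

module IntegerParity where
  open import Data.Bool using (true; false; _xor_)
  open import Data.Nat as ℕ using (ℕ; suc; _%_)
  import Data.Nat.Properties as ℕP
  import Data.Nat.DivMod as ℕDM
  open import Data.Integer using (ℤ; +_; -[1+_]; ∣_∣; _+_; _*_; -_; _-_)
  import Data.Integer.Properties as ℤP
  open import Data.Integer.DivMod using (_/ℕ_; _%ℕ_; a≡a%ℕn+[a/ℕn]*n; n%ℕd<d)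
  open import Data.Integer.Tactic.RingSolver using (solve-∀)
  open import Data.Sum using (_⊎_; inj₁; inj₂)
  open import Relation.Binary.PropositionalEquality

  isOdd-neg : ∀ z → isOdd (- z) ≡ isOdd z
  isOdd-neg z = cong (λ n → n % 2 ℕ.≡ᵇ 1) (ℤP.∣-i∣≡∣i∣ z)

  isOdd-2* : ∀ t → isOdd (+ 2 * t) ≡ false
  isOdd-2* t = cong (ℕ._≡ᵇ 1) (trans (cong (_% 2) (trans (ℤP.abs-* (+ 2) t) (ℕP.*-comm 2 ∣ t ∣))) (ℕDM.m*n%n≡0 ∣ t ∣ 2))

  ∣twoXplus1+∣ : ∀ n → ∣ twoXplus1 (+ n) ∣ ≡ 1 ℕ.+ n ℕ.* 2
  ∣twoXplus1+∣ n = trans (cong (λ z → ∣ z + + 1 ∣) (sym (ℤP.pos-* 2 n)))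
                        (trans (ℕP.+-comm (2 ℕ.* n) 1) (cong (1 ℕ.+_) (ℕP.*-comm 2 n)))

  -- -[1+ n ] computes to - (+ 1 + + n), so reflect applies at t = + n.
  ∣twoXplus1-∣ : ∀ n → ∣ twoXplus1 -[1+ n ] ∣ ≡ ∣ twoXplus1 (+ n) ∣
  ∣twoXplus1-∣ n = trans (cong ∣_∣ (reflect (+ n))) (ℤP.∣-i∣≡∣i∣ (twoXplus1 (+ n)))
    where
    reflect : ∀ t → + 2 * (- (+ 1 + t)) + + 1 ≡ - (+ 2 * t + + 1)
    reflect = solve-∀

  isOdd-twoXplus1 : ∀ t → isOdd (twoXplus1 t) ≡ true
  isOdd-twoXplus1 (+ n)    = cong (ℕ._≡ᵇ 1) (trans (cong (_% 2) (∣twoXplus1+∣ n)) (ℕDM.[m+kn]%n≡m%n 1 n 2))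
  isOdd-twoXplus1 -[1+ n ] = trans (cong (λ m → m % 2 ℕ.≡ᵇ 1) (∣twoXplus1-∣ n)) (isOdd-twoXplus1 (+ n))

  ∣∣≤∣twoXplus1∣ : ∀ t → ∣ t ∣ ℕ.≤ ∣ twoXplus1 t ∣
  ∣∣≤∣twoXplus1∣ (+ n)    = subst (n ℕ.≤_) (sym (∣twoXplus1+∣ n)) (ℕP.≤-trans (ℕP.m≤m*n n 2) (ℕP.n≤1+n _))
  ∣∣≤∣twoXplus1∣ -[1+ n ] = subst (suc n ℕ.≤_) (sym (trans (∣twoXplus1-∣ n) (∣twoXplus1+∣ n))) (ℕ.s≤s (ℕP.m≤m*n n 2))

  halve : ℤ → ℤ
  halve z = z /ℕ 2

  halve-spec : ∀ z → z ≡ + 2 * halve z ⊎ z ≡ twoXplus1 (halve z)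
  halve-spec z = by-remainder (z %ℕ 2) (halve z) (n%ℕd<d z 2) (a≡a%ℕn+[a/ℕn]*n z 2)
    where
    even : ∀ t → + 0 + t * + 2 ≡ + 2 * t
    even = solve-∀
    odd : ∀ t → + 1 + t * + 2 ≡ + 2 * t + + 1
    odd = solve-∀
    by-remainder : ∀ r t → r ℕ.< 2 → z ≡ + r + t * + 2 → z ≡ + 2 * t ⊎ z ≡ twoXplus1 t
    by-remainder 0 t _ e = inj₁ (trans e (even t))
    by-remainder 1 t _ e = inj₂ (trans e (odd t))
    by-remainder (suc (suc _)) t (ℕ.s≤s (ℕ.s≤s ())) e

  even⇒double-halve : ∀ z → isOdd z ≡ false → z ≡ + 2 * halve z
  even⇒double-halve z p with halve-spec z
  ... | inj₁ e = e
  ... | inj₂ e with trans (sym p) (trans (cong isOdd e) (isOdd-twoXplus1 (halve z)))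
  ...   | ()

  odd⇒twoXplus1-halve : ∀ z → isOdd z ≡ true → z ≡ twoXplus1 (halve z)
  odd⇒twoXplus1-halve z p with halve-spec z
  ... | inj₂ e = e
  ... | inj₁ e with trans (sym p) (trans (cong isOdd e) (isOdd-2* (halve z)))
  ...   | ()

  halve-2* : ∀ t → halve (+ 2 * t) ≡ t
  halve-2* t = sym (ℤP.*-cancelˡ-≡ (+ 2) t (halve (+ 2 * t)) (even⇒double-halve (+ 2 * t) (isOdd-2* t)))

  halve-twoXplus1 : ∀ t → halve (twoXplus1 t) ≡ t
  halve-twoXplus1 t = sym (ℤP.*-cancelˡ-≡ (+ 2) t h (begin
    + 2 * t                  ≡⟨ sym (drop1 (+ 2 * t)) ⟩
    twoXplus1 t - + 1        ≡⟨ cong (_- + 1) (odd⇒twoXplus1-halve (twoXplus1 t) (isOdd-twoXplus1 t)) ⟩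
    twoXplus1 h - + 1        ≡⟨ drop1 (+ 2 * h) ⟩
    + 2 * h                  ∎))
    where
    open ≡-Reasoning
    h : ℤ
    h = halve (twoXplus1 t)
    drop1 : ∀ x → x + + 1 - + 1 ≡ x
    drop1 = solve-∀

  isOdd-+ : ∀ u v → isOdd (u + v) ≡ isOdd u xor isOdd v
  isOdd-+ u v with halve u | halve v | halve-spec u | halve-spec v
  ... | a | b | inj₁ refl | inj₁ refl
    rewrite isOdd-2* a | isOdd-2* b = trans (cong isOdd (regroup a b)) (isOdd-2* (a + b))
    where regroup : ∀ a b → + 2 * a + + 2 * b ≡ + 2 * (a + b)
          regroup = solve-∀
  ... | a | b | inj₁ refl | inj₂ refl
    rewrite isOdd-2* a | isOdd-twoXplus1 b = trans (cong isOdd (regroup a b)) (isOdd-twoXplus1 (a + b))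
    where regroup : ∀ a b → + 2 * a + (+ 2 * b + + 1) ≡ + 2 * (a + b) + + 1
          regroup = solve-∀
  ... | a | b | inj₂ refl | inj₁ refl
    rewrite isOdd-twoXplus1 a | isOdd-2* b = trans (cong isOdd (regroup a b)) (isOdd-twoXplus1 (a + b))
    where regroup : ∀ a b → + 2 * a + + 1 + + 2 * b ≡ + 2 * (a + b) + + 1
          regroup = solve-∀
  ... | a | b | inj₂ refl | inj₂ refl
    rewrite isOdd-twoXplus1 a | isOdd-twoXplus1 b = trans (cong isOdd (regroup a b)) (isOdd-2* (a + b + + 1))
    where regroup : ∀ a b → + 2 * a + + 1 + (+ 2 * b + + 1) ≡ + 2 * (a + b + + 1)
          regroup = solve-∀

  isOdd-- : ∀ u v → isOdd (u - v) ≡ isOdd u xor isOdd v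
  isOdd-- u v = trans (isOdd-+ u (- v)) (cong (isOdd u xor_) (isOdd-neg v))


module LatticeCounting where
  open import Data.Bool using (Bool; true; false; T; _∧_; not)
  open import Data.Bool.Properties using (T-∧)
  open import Data.Nat as ℕ using (ℕ; zero; suc; _≤_; _≡ᵇ_; s≤s)
  import Data.Nat.Properties as ℕP
  open import Data.Integer using (ℤ; +_; -[1+_]; ∣_∣)
  open import Data.Fin using (zero; suc)
  open import Data.Vec using (Vec; []; _∷_; lookup)
  import Data.Vec.Properties as VecP
  open import Data.List as List using (List; length; filterᵇ; upTo; map; concatMap; cartesianProductWith)
  open import Data.List.Properties using (length-map; map-id-local; map-∘)
  open import Data.List.Membership.Propositional using (_∈_)
  open import Data.List.Membership.Propositional.Properties
    using (∈-map⁺; ∈-map⁻; ∈-++⁺ˡ; ∈-++⁺ʳ; ∈-upTo⁺; ∈-filter⁺; ∈-filter⁻; ∈-cartesianProductWith⁺)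
  open import Data.List.Membership.Propositional.Properties.WithK using (unique∧set⇒bag)
  import Data.List.Relation.Unary.All as All
  open import Data.List.Relation.Unary.Any using (here)
  open import Data.List.Relation.Unary.AllPairs using ([]; _∷_)
  open import Data.List.Relation.Unary.Unique.Propositional using (Unique)
  import Data.List.Relation.Unary.Unique.Propositional.Properties as Unique
  open import Data.List.Relation.Binary.BagAndSetEquality using (∼bag⇒↭)
  open import Data.List.Relation.Binary.Permutation.Propositional.Properties using (↭-length)
  open import Data.Empty using (⊥)
  open import Data.Product using (_×_; _,_; proj₁; proj₂)
  open import Function using (_∘_; mk⇔; Equivalence)
  open import Relation.Nullary.Decidable using (T?)
  open import Relation.Binary.PropositionalEquality

  ∧-intro : ∀ a {b} → T a → T b → T (a ∧ b)
  ∧-intro _ p q = Equivalence.from T-∧ (p , q)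

  ∧-elimˡ : ∀ a {b} → T (a ∧ b) → T a
  ∧-elimˡ _ = proj₁ ∘ Equivalence.to T-∧

  ∧-elimʳ : ∀ a {b} → T (a ∧ b) → T b
  ∧-elimʳ _ = proj₂ ∘ Equivalence.to T-∧

  module _ {A B : Set} (P : A → Bool) (Q : B → Bool) (to : A → B) (from : B → A) where

    length-filter-bijection : ∀ {xs ys} → Unique xs → Unique ys
      → (∀ {x} → x ∈ xs → T (P x) → to x ∈ ys × T (Q (to x)) × from (to x) ≡ x)
      → (∀ {y} → y ∈ ys → T (Q y) → from y ∈ xs × T (P (from y)) × to (from y) ≡ y)
      → length (filterᵇ P xs) ≡ length (filterᵇ Q ys)
    length-filter-bijection {xs} {ys} xs! ys! forth back = begin
      length (filterᵇ P xs)           ≡⟨ length-map to (filterᵇ P xs) ⟨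
      length (map to (filterᵇ P xs))  ≡⟨ ↭-length (∼bag⇒↭ (unique∧set⇒bag image! Qys! (mk⇔ image⊆ ⊆image))) ⟩
      length (filterᵇ Q ys)           ∎
      where
      open ≡-Reasoning
      ∈Pxs⁻ : ∀ {x} → x ∈ filterᵇ P xs → x ∈ xs × T (P x)
      ∈Pxs⁻ = ∈-filter⁻ (T? ∘ P)
      Qys! : Unique (filterᵇ Q ys)
      Qys! = Unique.filter⁺ (T? ∘ Q) ys!
      from∘to≡id : map from (map to (filterᵇ P xs)) ≡ filterᵇ P xs
      from∘to≡id = trans (sym (map-∘ (filterᵇ P xs)))
        (map-id-local (All.tabulate (λ x∈ → let x∈xs , Px = ∈Pxs⁻ x∈ in proj₂ (proj₂ (forth x∈xs Px)))))
      image! : Unique (map to (filterᵇ P xs))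
      image! = Unique.map⁻ (subst Unique (sym from∘to≡id) (Unique.filter⁺ (T? ∘ P) xs!))
      image⊆ : ∀ {y} → y ∈ map to (filterᵇ P xs) → y ∈ filterᵇ Q ys
      image⊆ y∈ with ∈-map⁻ to y∈
      ... | x , x∈ , refl = let x∈xs , Px = ∈Pxs⁻ x∈ ; y∈ys , Qy , _ = forth x∈xs Px in ∈-filter⁺ (T? ∘ Q) y∈ys Qy
      ⊆image : ∀ {y} → y ∈ filterᵇ Q ys → y ∈ map to (filterᵇ P xs)
      ⊆image y∈ with ∈-filter⁻ (T? ∘ Q) y∈
      ... | y∈ys , Qy with back y∈ys Qy
      ...   | x∈xs , Px , to-from = subst (_∈ map to (filterᵇ P xs)) to-from (∈-map⁺ to (∈-filter⁺ (T? ∘ P) x∈xs Px))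

  length-filterᵇ-split : ∀ {A : Set} (p r q : A → Bool) xs
    → length (filterᵇ (λ x → p x ∧ q x) xs)
      ≡ length (filterᵇ (λ x → (p x ∧ r x) ∧ q x) xs) ℕ.+ length (filterᵇ (λ x → (p x ∧ not (r x)) ∧ q x) xs)
  length-filterᵇ-split p r q List.[] = refl
  length-filterᵇ-split p r q (x List.∷ xs) with p x | r x | q x
  ... | false | _     | _     = length-filterᵇ-split p r q xs
  ... | true  | true  | false = length-filterᵇ-split p r q xs
  ... | true  | false | false = length-filterᵇ-split p r q xs
  ... | true  | true  | true  = cong suc (length-filterᵇ-split p r q xs)
  ... | true  | false | true  = trans (cong suc (length-filterᵇ-split p r q xs)) (sym (ℕP.+-suc _ _))

  range-complete : ∀ m z → ∣ z ∣ ≤ m → z ∈ range m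
  range-complete m (+ n)    n≤m = ∈-++⁺ˡ (∈-map⁺ +_ (∈-upTo⁺ (s≤s n≤m)))
  range-complete m -[1+ n ] n<m = ∈-++⁺ʳ (map +_ (upTo (suc m))) (∈-map⁺ -[1+_] (∈-upTo⁺ n<m))

  range-unique : ∀ m → Unique (range m)
  range-unique m = Unique.++⁺ (Unique.map⁺ (λ { refl → refl }) (Unique.upTo⁺ (suc m)))
                              (Unique.map⁺ (λ { refl → refl }) (Unique.upTo⁺ m))
                              signs-differ
    where
    signs-differ : ∀ {z} → z ∈ map +_ (upTo (suc m)) × z ∈ map -[1+_] (upTo m) → ⊥
    signs-differ (p , q) with ∈-map⁻ +_ p | ∈-map⁻ -[1+_] q
    ... | _ , _ , refl | _ , _ , ()

  box-suc : ∀ n m → box (suc n) m ≡ cartesianProductWith _∷_ (range m) (box n m)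
  box-suc n m = go (range m)
    where
    go : ∀ zs → concatMap (λ z → map (z ∷_) (box n m)) zs ≡ cartesianProductWith _∷_ zs (box n m)
    go List.[]       = refl
    go (z List.∷ zs) = cong (map (z ∷_) (box n m) List.++_) (go zs)

  box-complete : ∀ n m (y : Vec ℤ n) → (∀ i → ∣ lookup y i ∣ ≤ m) → y ∈ box n m
  box-complete zero    m []      _       = here refl
  box-complete (suc n) m (z ∷ y) bounded = subst (z ∷ y ∈_) (sym (box-suc n m))
    (∈-cartesianProductWith⁺ _∷_ (range-complete m z (bounded zero)) (box-complete n m y (bounded ∘ suc)))

  box-unique : ∀ n m → Unique (box n m)
  box-unique zero    m = All.[] ∷ []
  box-unique (suc n) m = subst Unique (sym (box-suc n m))
    (Unique.cartesianProductWith⁺ _∷_ VecP.∷-injective (range-unique m) (box-unique n m))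

  -- Guarantees that the box [-m, m]ⁿ enumerated by thetaCoeff contains the whole norm-m shell.
  CoordinatesBoundedBy : ∀ {n} → (Vec ℤ n → ℕ) → Set
  CoordinatesBoundedBy Q = ∀ y i → ∣ lookup y i ∣ ≤ Q y

  ∣∣≤sq : ∀ z → ∣ z ∣ ≤ sq z
  ∣∣≤sq z with ∣ z ∣
  ... | zero  = ℕ.z≤n
  ... | suc n = ℕP.m≤m*n (suc n) (suc n)

  sumSq-bounds : ∀ {n} → CoordinatesBoundedBy {n} sumSq
  sumSq-bounds (z ∷ y) zero    = ℕP.≤-trans (∣∣≤sq z) (ℕP.m≤m+n (sq z) (sumSq y))
  sumSq-bounds (z ∷ y) (suc i) = ℕP.≤-trans (sumSq-bounds y i) (ℕP.m≤n+m (sumSq y) (sq z))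

  bounds-mono : ∀ {n} {Q Q′ : Vec ℤ n → ℕ} → CoordinatesBoundedBy Q → (∀ y → Q y ≤ Q′ y) → CoordinatesBoundedBy Q′
  bounds-mono bounded Q≤Q′ y i = ℕP.≤-trans (bounded y i) (Q≤Q′ y)

  record Isometry {n n′} (mem : Vec ℤ n → Bool) (Q : Vec ℤ n → ℕ)
                  (mem′ : Vec ℤ n′ → Bool) (Q′ : Vec ℤ n′ → ℕ) : Set where
    field
      to       : Vec ℤ n → Vec ℤ n′
      from     : Vec ℤ n′ → Vec ℤ n
      to-mem   : ∀ {y} → T (mem y) → T (mem′ (to y))
      from-mem : ∀ {x} → T (mem′ x) → T (mem (from x))
      to-norm  : ∀ {y} → T (mem y) → Q′ (to y) ≡ Q y
      from-to  : ∀ {y} → T (mem y) → from (to y) ≡ y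
      to-from  : ∀ {x} → T (mem′ x) → to (from x) ≡ x

  thetaCoeff-isometry : ∀ {n n′ mem Q mem′ Q′} → CoordinatesBoundedBy Q → CoordinatesBoundedBy Q′
    → Isometry mem Q mem′ Q′ → ∀ m → thetaCoeff n mem Q m ≡ thetaCoeff n′ mem′ Q′ m
  thetaCoeff-isometry {n} {n′} {mem} {Q} {mem′} {Q′} Q-bounds Q′-bounds iso m =
    length-filter-bijection _ _ to from (box-unique n m) (box-unique n′ m) forth back
    where
    open Isometry iso
    in-shell : ∀ {k} (mem : Vec ℤ k → Bool) (Q : Vec ℤ k → ℕ) y → T (mem y) → Q y ≡ m → T (mem y ∧ (Q y ≡ᵇ m))
    in-shell mem Q y p e = ∧-intro (mem y) p (ℕP.≡⇒≡ᵇ (Q y) m e)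
    norm-in-shell : ∀ {k} (mem : Vec ℤ k → Bool) (Q : Vec ℤ k → ℕ) y → T (mem y ∧ (Q y ≡ᵇ m)) → Q y ≡ m
    norm-in-shell mem Q y p = ℕP.≡ᵇ⇒≡ (Q y) m (∧-elimʳ (mem y) p)
    forth : ∀ {y} → y ∈ box n m → T (mem y ∧ (Q y ≡ᵇ m))
      → to y ∈ box n′ m × T (mem′ (to y) ∧ (Q′ (to y) ≡ᵇ m)) × from (to y) ≡ y
    forth {y} _ p = box-complete n′ m (to y) (λ i → subst (_ ≤_) Qto (Q′-bounds (to y) i)) ,
                    in-shell mem′ Q′ (to y) (to-mem my) Qto , from-to my
      where
      my : T (mem y)
      my = ∧-elimˡ (mem y) p
      Qto : Q′ (to y) ≡ m
      Qto = trans (to-norm my) (norm-in-shell mem Q y p)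
    back : ∀ {x} → x ∈ box n′ m → T (mem′ x ∧ (Q′ x ≡ᵇ m))
      → from x ∈ box n m × T (mem (from x) ∧ (Q (from x) ≡ᵇ m)) × to (from x) ≡ x
    back {x} _ p = box-complete n m (from x) (λ i → subst (_ ≤_) Qfrom (Q-bounds (from x) i)) ,
                   in-shell mem Q (from x) (from-mem mx) Qfrom , to-from mx
      where
      mx : T (mem′ x)
      mx = ∧-elimˡ (mem′ x) p
      Qfrom : Q (from x) ≡ m
      Qfrom = trans (sym (to-norm (from-mem mx))) (trans (cong Q′ (to-from mx)) (norm-in-shell mem′ Q′ x p))

  thetaCoeff-split : ∀ n mem Q (R : Vec ℤ n → Bool) m → thetaCoeff n mem Q m
    ≡ thetaCoeff n (λ y → mem y ∧ R y) Q m ℕ.+ thetaCoeff n (λ y → mem y ∧ not (R y)) Q m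
  thetaCoeff-split n mem Q R m = length-filterᵇ-split mem R (λ y → Q y ≡ᵇ m) (box n m)


module DualLattice where
  open import Data.Bool using (Bool; true; false; T; _∧_; _∨_; not)
  open import Data.Bool.Properties using (T-∨; T-not-≡)
  open import Data.Unit using (tt)
  open import Data.Nat as ℕ using (zero; suc; _≤_; _+_; _*_)
  import Data.Nat.Properties as ℕP
  import Data.Nat.Tactic.RingSolver as ℕSolver
  open import Data.Integer as ℤ using (ℤ; +_; ∣_∣)
  import Data.Integer.Properties as ℤP
  open import Data.Fin using (zero; suc)
  open import Data.Vec using (Vec; []; _∷_; lookup; map)
  import Data.Vec.Properties as VecP
  open import Data.Vec.Relation.Unary.All using (All; []; _∷_)
  open import Data.Product using (Σ; _,_)
  open import Data.Sum using (inj₁; inj₂)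
  open import Data.Empty using (⊥-elim)
  open import Function using (Equivalence)
  open import Relation.Binary.PropositionalEquality
  open IntegerParity
  open LatticeCounting

  allEven : ∀ {n} → Vec ℤ n → Bool
  allEven = allᵇ (λ z → not (isOdd z))

  -- Literally the membership test of θ-Dstar2, so D*ₙ(2) is thetaCoeff n allSameParity sumSq.
  allSameParity : ∀ {n} → Vec ℤ n → Bool
  allSameParity y = allEven y ∨ allᵇ isOdd y

  HasParity : Bool → ℤ → Set
  HasParity t z = isOdd z ≡ t

  allSameParity-intro : ∀ {n} t (y : Vec ℤ n) → All (HasParity t) y → T (allSameParity y)
  allSameParity-intro false y p = Equivalence.from T-∨ (inj₁ (even y p))
    where
    even : ∀ {n} (y : Vec ℤ n) → All (HasParity false) y → T (allEven y)
    even []      []       = tt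
    even (z ∷ y) (p ∷ ps) rewrite p = even y ps
  allSameParity-intro true y p = Equivalence.from T-∨ (inj₂ (odd y p))
    where
    odd : ∀ {n} (y : Vec ℤ n) → All (HasParity true) y → T (allᵇ isOdd y)
    odd []      []       = tt
    odd (z ∷ y) (p ∷ ps) rewrite p = odd y ps

  allSameParity-elim : ∀ {n} (y : Vec ℤ n) → T (allSameParity y) → Σ Bool λ t → All (HasParity t) y
  allSameParity-elim y p with Equivalence.to T-∨ p
  ... | inj₁ p = false , even y p
    where
    even : ∀ {n} (y : Vec ℤ n) → T (allEven y) → All (HasParity false) y
    even []      _ = []
    even (z ∷ y) p with isOdd z in e
    ... | false = e ∷ even y p
  ... | inj₂ p = true , odd y p
    where
    odd : ∀ {n} (y : Vec ℤ n) → T (allᵇ isOdd y) → All (HasParity true) y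
    odd []      _ = []
    odd (z ∷ y) p with isOdd z in e
    ... | true = e ∷ odd y p

  sq-2* : ∀ t → sq (+ 2 ℤ.* t) ≡ 4 * sq t
  sq-2* t = trans (cong (λ a → a * a) (ℤP.abs-* (+ 2) t)) (square ∣ t ∣)
    where
    square : ∀ a → 2 * a * (2 * a) ≡ 4 * (a * a)
    square = ℕSolver.solve-∀

  sumSq-map-2* : ∀ {n} (x : Vec ℤ n) → sumSq (map (+ 2 ℤ.*_) x) ≡ 4 * sumSq x
  sumSq-map-2* []      = refl
  sumSq-map-2* (t ∷ x) = trans (cong₂ _+_ (sq-2* t) (sumSq-map-2* x)) (sym (ℕP.*-distribˡ-+ 4 (sq t) (sumSq x)))

  allEven-map-2* : ∀ {n} (x : Vec ℤ n) → T (allEven (map (+ 2 ℤ.*_) x))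
  allEven-map-2* []      = tt
  allEven-map-2* (t ∷ x) rewrite isOdd-2* t = allEven-map-2* x

  allOdd-map-twoXplus1 : ∀ {n} (x : Vec ℤ n) → T (allᵇ isOdd (map twoXplus1 x))
  allOdd-map-twoXplus1 []      = tt
  allOdd-map-twoXplus1 (t ∷ x) rewrite isOdd-twoXplus1 t = allOdd-map-twoXplus1 x

  allOdd⇒¬allEven : ∀ {n} (y : Vec ℤ (suc n)) → T (allᵇ isOdd y) → allEven y ≡ false
  allOdd⇒¬allEven (z ∷ y) odd with isOdd z
  ... | true = refl

  map-2*-halve : ∀ {n} (y : Vec ℤ n) → T (allEven y) → map (+ 2 ℤ.*_) (map halve y) ≡ y
  map-2*-halve []      _ = refl
  map-2*-halve (z ∷ y) even with isOdd z in z-parity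
  ... | false = cong₂ _∷_ (sym (even⇒double-halve z z-parity)) (map-2*-halve y even)

  map-twoXplus1-halve : ∀ {n} (y : Vec ℤ n) → T (allᵇ isOdd y) → map twoXplus1 (map halve y) ≡ y
  map-twoXplus1-halve []      _ = refl
  map-twoXplus1-halve (z ∷ y) odd with isOdd z in z-parity
  ... | true = cong₂ _∷_ (sym (odd⇒twoXplus1-halve z z-parity)) (map-twoXplus1-halve y odd)

  map-halve-2* : ∀ {n} (x : Vec ℤ n) → map halve (map (+ 2 ℤ.*_) x) ≡ x
  map-halve-2* []      = refl
  map-halve-2* (t ∷ x) = cong₂ _∷_ (halve-2* t) (map-halve-2* x)

  map-halve-twoXplus1 : ∀ {n} (x : Vec ℤ n) → map halve (map twoXplus1 x) ≡ x
  map-halve-twoXplus1 []      = refl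
  map-halve-twoXplus1 (t ∷ x) = cong₂ _∷_ (halve-twoXplus1 t) (map-halve-twoXplus1 x)

  sameParity∧¬allEven⇒allOdd : ∀ {n} (y : Vec ℤ n) → T (allSameParity y) → T (not (allEven y)) → T (allᵇ isOdd y)
  sameParity∧¬allEven⇒allOdd y same ¬even with allEven y
  ... | false = same

  even-coordinates : ∀ {n} → Isometry (λ y → allSameParity y ∧ allEven y) sumSq (λ _ → true) (λ x → 4 * sumSq {n} x)
  even-coordinates = record
    { to       = map halve
    ; from     = map (+ 2 ℤ.*_)
    ; to-mem   = λ _ → tt
    ; from-mem = λ {x} _ → ∧-intro (allSameParity (map (+ 2 ℤ.*_) x)) (Equivalence.from T-∨ (inj₁ (allEven-map-2* x))) (allEven-map-2* x)
    ; to-norm  = λ {y} p → trans (sym (sumSq-map-2* (map halve y))) (cong sumSq (map-2*-halve y (∧-elimʳ (allSameParity y) p)))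
    ; from-to  = λ {y} p → map-2*-halve y (∧-elimʳ (allSameParity y) p)
    ; to-from  = λ {x} _ → map-halve-2* x
    }

  odd-coordinates : ∀ {n} → Isometry (λ y → allSameParity y ∧ not (allEven y)) sumSq
                                      (λ _ → true) (λ x → sumSq {suc n} (map twoXplus1 x))
  odd-coordinates = record
    { to       = map halve
    ; from     = map twoXplus1
    ; to-mem   = λ _ → tt
    ; from-mem = λ {x} _ → let odd = allOdd-map-twoXplus1 x in
        ∧-intro (allSameParity (map twoXplus1 x)) (Equivalence.from T-∨ (inj₂ odd)) (Equivalence.from T-not-≡ (allOdd⇒¬allEven (map twoXplus1 x) odd))
    ; to-norm  = λ {y} p → cong sumSq (map-twoXplus1-halve y (allOdd y p))
    ; from-to  = λ {y} p → map-twoXplus1-halve y (allOdd y p)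
    ; to-from  = λ {x} _ → map-halve-twoXplus1 x
    }
    where
    allOdd : ∀ {n} (y : Vec ℤ n) → T (allSameParity y ∧ not (allEven y)) → T (allᵇ isOdd y)
    allOdd y p = sameParity∧¬allEven⇒allOdd y (∧-elimˡ (allSameParity y) p) (∧-elimʳ (allSameParity y) p)

  -- For n = 0 the empty vector is both all even and all odd, and the identity fails.
  θ-Dstar2-split : ∀ n → n ≢ 0 → ∀ m → θ-Dstar2 n m ≡ θ3q2pow n m + θ2q2pow n m
  θ-Dstar2-split zero    0≢0 m = ⊥-elim (0≢0 refl)
  θ-Dstar2-split (suc n) _   m = trans (thetaCoeff-split (suc n) allSameParity sumSq allEven m)
    (cong₂ _+_ (thetaCoeff-isometry sumSq-bounds (bounds-mono sumSq-bounds (λ x → ℕP.m≤n*m (sumSq x) 4)) (even-coordinates {suc n}) m)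
               (thetaCoeff-isometry sumSq-bounds twoXplus1-bounds (odd-coordinates {n}) m))
    where
    twoXplus1-bounds : CoordinatesBoundedBy (λ x → sumSq {suc n} (map twoXplus1 x))
    twoXplus1-bounds x i = ℕP.≤-trans (∣∣≤∣twoXplus1∣ (lookup x i))
      (subst (_≤ _) (cong ∣_∣ (VecP.lookup-map i twoXplus1 x)) (sumSq-bounds (map twoXplus1 x) i))


module PairLattice where
  open import Data.Bool using (Bool; true; false; T; _xor_)
  open import Data.Nat as ℕ using (ℕ)
  import Data.Nat.Properties as ℕP
  import Data.Nat.Tactic.RingSolver as ℕSolver
  open import Algebra.Properties.CommutativeSemigroup ℕP.+-commutativeSemigroup using (interchange)
  open import Data.Integer using (ℤ; +_; -[1+_]; _+_; _-_; _*_)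
  import Data.Integer.Properties as ℤP
  open import Data.Integer.Tactic.RingSolver using (solve-∀)
  open import Data.Vec using (Vec; []; _∷_; zipWith; take; drop; _++_)
  import Data.Vec.Properties as VecP
  open import Data.Vec.Relation.Unary.All using (All; []; _∷_)
  import Data.Vec.Relation.Unary.All.Properties as AllP
  open import Data.Product using (Σ; _×_; _,_; proj₁; proj₂)
  open import Function using (_∘_)
  open import Relation.Binary.PropositionalEquality
  open IntegerParity
  open LatticeCounting
  open DualLattice

  take-++ : ∀ {A : Set} m {n} (u : Vec A m) (v : Vec A n) → take m (u ++ v) ≡ u
  take-++ m u v = VecP.++-injectiveˡ (take m (u ++ v)) u (VecP.take++drop≡id m (u ++ v))

  drop-++ : ∀ {A : Set} m {n} (u : Vec A m) (v : Vec A n) → drop m (u ++ v) ≡ v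
  drop-++ m u v = VecP.++-injectiveʳ (take m (u ++ v)) u (VecP.take++drop≡id m (u ++ v))

  by-halves : ∀ {A : Set} {n} (P : Vec A (n ℕ.+ n) → Set) → (∀ u v → P (u ++ v)) → ∀ y → P y
  by-halves {n = n} P h y = subst P (VecP.take++drop≡id n y) (h (take n y) (drop n y))

  sumSq-++ : ∀ {m n} (x : Vec ℤ m) (y : Vec ℤ n) → sumSq (x ++ y) ≡ sumSq x ℕ.+ sumSq y
  sumSq-++ []      y = refl
  sumSq-++ (z ∷ x) y = trans (cong (sq z ℕ.+_) (sumSq-++ x y)) (sym (ℕP.+-assoc (sq z) _ _))

  sq-+-sq-- : ∀ a b → sq (a + b) ℕ.+ sq (a - b) ≡ 2 ℕ.* (sq a ℕ.+ sq b)
  sq-+-sq-- a b = ℤP.+-injective (begin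
    + (sq (a + b) ℕ.+ sq (a - b))   ≡⟨ ℤP.pos-+ (sq (a + b)) (sq (a - b)) ⟩
    + sq (a + b) + + sq (a - b)     ≡⟨ cong₂ _+_ (+sq (a + b)) (+sq (a - b)) ⟩
    (a + b) * (a + b) + (a - b) * (a - b)   ≡⟨ parallelogram a b ⟩
    + 2 * (a * a + b * b)                   ≡⟨ cong (λ z → + 2 * z) (sym (cong₂ _+_ (+sq a) (+sq b))) ⟩
    + 2 * (+ sq a + + sq b)                 ≡⟨ cong (+ 2 *_) (sym (ℤP.pos-+ (sq a) (sq b))) ⟩
    + 2 * + (sq a ℕ.+ sq b)                 ≡⟨ sym (ℤP.pos-* 2 (sq a ℕ.+ sq b)) ⟩
    + (2 ℕ.* (sq a ℕ.+ sq b))               ∎)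
    where
    open ≡-Reasoning
    +sq : ∀ z → + sq z ≡ z * z
    +sq (+ n)      = ℤP.pos-* n n
    +sq -[1+ n ] = refl
    parallelogram : ∀ a b → (a + b) * (a + b) + (a - b) * (a - b) ≡ + 2 * (a * a + b * b)
    parallelogram = solve-∀

  sumSq-rotate : ∀ {n} (u v : Vec ℤ n) → sumSq (zipWith _+_ u v) ℕ.+ sumSq (zipWith _-_ u v) ≡ 2 ℕ.* (sumSq u ℕ.+ sumSq v)
  sumSq-rotate []      []      = refl
  sumSq-rotate (a ∷ u) (b ∷ v) = begin
    (sq (a + b) ℕ.+ sumSq (zipWith _+_ u v)) ℕ.+ (sq (a - b) ℕ.+ sumSq (zipWith _-_ u v))
      ≡⟨ interchange (sq (a + b)) _ (sq (a - b)) _ ⟩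
    (sq (a + b) ℕ.+ sq (a - b)) ℕ.+ (sumSq (zipWith _+_ u v) ℕ.+ sumSq (zipWith _-_ u v))
      ≡⟨ cong₂ ℕ._+_ (sq-+-sq-- a b) (sumSq-rotate u v) ⟩
    2 ℕ.* (sq a ℕ.+ sq b) ℕ.+ 2 ℕ.* (sumSq u ℕ.+ sumSq v)
      ≡⟨ regroup (sq a) (sq b) (sumSq u) (sumSq v) ⟩
    2 ℕ.* ((sq a ℕ.+ sumSq u) ℕ.+ (sq b ℕ.+ sumSq v))   ∎
    where
    open ≡-Reasoning
    regroup : ∀ w x y z → 2 ℕ.* (w ℕ.+ x) ℕ.+ 2 ℕ.* (y ℕ.+ z) ≡ 2 ℕ.* ((w ℕ.+ y) ℕ.+ (x ℕ.+ z))
    regroup = ℕSolver.solve-∀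

  halfSum halfDiff : ℤ → ℤ → ℤ
  halfSum  s d = halve (s + d)
  halfDiff s d = halve (s - d)

  halves-of-rotation : ∀ a b → halfSum (a + b) (a - b) ≡ a × halfDiff (a + b) (a - b) ≡ b
  halves-of-rotation a b = trans (cong halve (sum≡ a b)) (halve-2* a) , trans (cong halve (diff≡ a b)) (halve-2* b)
    where
    sum≡ : ∀ a b → (a + b) + (a - b) ≡ + 2 * a
    sum≡ = solve-∀
    diff≡ : ∀ a b → (a + b) - (a - b) ≡ + 2 * b
    diff≡ = solve-∀

  rotation-of-halves : ∀ s d → isOdd s ≡ isOdd d → halfSum s d + halfDiff s d ≡ s × halfSum s d - halfDiff s d ≡ d
  rotation-of-halves s d same =
      ℤP.*-cancelˡ-≡ (+ 2) _ s (begin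
        + 2 * (halfSum s d + halfDiff s d)   ≡⟨ ℤP.*-distribˡ-+ (+ 2) (halfSum s d) (halfDiff s d) ⟩
        + 2 * halfSum s d + + 2 * halfDiff s d   ≡⟨ cong₂ _+_ (sym s+d) (sym s-d) ⟩
        (s + d) + (s - d)                    ≡⟨ sum≡ s d ⟩
        + 2 * s                              ∎)
    , ℤP.*-cancelˡ-≡ (+ 2) _ d (begin
        + 2 * (halfSum s d - halfDiff s d)   ≡⟨ 2*-distrib-- (halfSum s d) (halfDiff s d) ⟩
        + 2 * halfSum s d - + 2 * halfDiff s d   ≡⟨ cong₂ _-_ (sym s+d) (sym s-d) ⟩
        (s + d) - (s - d)                    ≡⟨ diff≡ s d ⟩
        + 2 * d                              ∎)
    where
    open ≡-Reasoning
    xor-same : ∀ {x y} → x ≡ y → x xor y ≡ false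
    xor-same {false} refl = refl
    xor-same {true}  refl = refl
    s+d : s + d ≡ + 2 * halfSum s d
    s+d = even⇒double-halve (s + d) (trans (isOdd-+ s d) (xor-same same))
    s-d : s - d ≡ + 2 * halfDiff s d
    s-d = even⇒double-halve (s - d) (trans (isOdd-- s d) (xor-same same))
    sum≡ : ∀ s d → (s + d) + (s - d) ≡ + 2 * s
    sum≡ = solve-∀
    diff≡ : ∀ s d → (s + d) - (s - d) ≡ + 2 * d
    diff≡ = solve-∀
    2*-distrib-- : ∀ x y → + 2 * (x - y) ≡ + 2 * x - + 2 * y
    2*-distrib-- = solve-∀

  halfSums-rotated : ∀ {n} (u v : Vec ℤ n) → zipWith halfSum (zipWith _+_ u v) (zipWith _-_ u v) ≡ u
  halfSums-rotated []      []      = refl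
  halfSums-rotated (a ∷ u) (b ∷ v) = cong₂ _∷_ (proj₁ (halves-of-rotation a b)) (halfSums-rotated u v)

  halfDiffs-rotated : ∀ {n} (u v : Vec ℤ n) → zipWith halfDiff (zipWith _+_ u v) (zipWith _-_ u v) ≡ v
  halfDiffs-rotated []      []      = refl
  halfDiffs-rotated (a ∷ u) (b ∷ v) = cong₂ _∷_ (proj₂ (halves-of-rotation a b)) (halfDiffs-rotated u v)

  sums-of-halves : ∀ {n t} (s d : Vec ℤ n) → All (HasParity t) s → All (HasParity t) d
    → zipWith _+_ (zipWith halfSum s d) (zipWith halfDiff s d) ≡ s
  sums-of-halves []      []      []       []       = refl
  sums-of-halves (a ∷ s) (b ∷ d) (pa ∷ ps) (pb ∷ pd) =
    cong₂ _∷_ (proj₁ (rotation-of-halves a b (trans pa (sym pb)))) (sums-of-halves s d ps pd)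

  diffs-of-halves : ∀ {n t} (s d : Vec ℤ n) → All (HasParity t) s → All (HasParity t) d
    → zipWith _-_ (zipWith halfSum s d) (zipWith halfDiff s d) ≡ d
  diffs-of-halves []      []      []       []       = refl
  diffs-of-halves (a ∷ s) (b ∷ d) (pa ∷ ps) (pb ∷ pd) =
    cong₂ _∷_ (proj₂ (rotation-of-halves a b (trans pa (sym pb)))) (diffs-of-halves s d ps pd)

  parity-of-differences : ∀ {n t} (u v : Vec ℤ n) → All (HasParity t) (zipWith _+_ u v) → All (HasParity t) (zipWith _-_ u v)
  parity-of-differences []      []      []       = []
  parity-of-differences (a ∷ u) (b ∷ v) (p ∷ ps) =
    trans (trans (isOdd-- a b) (sym (isOdd-+ a b))) p ∷ parity-of-differences u v ps

  -- A pair (u, v) ∈ ℤⁿ × ℤⁿ is encoded as u ++ v.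
  module _ {n : ℕ} where

    pairwise : (ℤ → ℤ → ℤ) → (ℤ → ℤ → ℤ) → Vec ℤ (n ℕ.+ n) → Vec ℤ (n ℕ.+ n)
    pairwise f g y = zipWith f (take n y) (drop n y) ++ zipWith g (take n y) (drop n y)

    pairwise-++ : ∀ f g (u v : Vec ℤ n) → pairwise f g (u ++ v) ≡ zipWith f u v ++ zipWith g u v
    pairwise-++ f g u v rewrite take-++ n u v | drop-++ n u v = refl

    pairSums : Vec ℤ (n ℕ.+ n) → Vec ℤ n
    pairSums y = zipWith _+_ (take n y) (drop n y)

    pairSums-++ : ∀ (u v : Vec ℤ n) → pairSums (u ++ v) ≡ zipWith _+_ u v
    pairSums-++ u v rewrite take-++ n u v | drop-++ n u v = refl

    rotate unrotate : Vec ℤ (n ℕ.+ n) → Vec ℤ (n ℕ.+ n)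
    rotate   = pairwise _+_ _-_
    unrotate = pairwise halfSum halfDiff

    SameParityPairs : Vec ℤ (n ℕ.+ n) → Set
    SameParityPairs y = T (allSameParity (pairSums y))

    rotate-sameParity : ∀ (u v : Vec ℤ n) → SameParityPairs (u ++ v) → T (allSameParity (rotate (u ++ v)))
    rotate-sameParity u v p with allSameParity-elim (zipWith _+_ u v) (subst (T ∘ allSameParity) (pairSums-++ u v) p)
    ... | t , sums = subst (T ∘ allSameParity) (sym (pairwise-++ _+_ _-_ u v))
      (allSameParity-intro t _ (AllP.++⁺ sums (parity-of-differences u v sums)))

    halves-have-parity : ∀ (s d : Vec ℤ n) → T (allSameParity (s ++ d)) → Σ Bool λ t → All (HasParity t) s × All (HasParity t) d
    halves-have-parity s d p with allSameParity-elim (s ++ d) p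
    ... | t , both = t , AllP.++ˡ⁻ s both , AllP.++ʳ⁻ s both

    unrotate-sameParity : ∀ (s d : Vec ℤ n) → T (allSameParity (s ++ d)) → SameParityPairs (unrotate (s ++ d))
    unrotate-sameParity s d p with halves-have-parity s d p
    ... | t , ps , pd = subst (T ∘ allSameParity) (sym (begin
      pairSums (unrotate (s ++ d))                              ≡⟨ cong pairSums (pairwise-++ halfSum halfDiff s d) ⟩
      pairSums (zipWith halfSum s d ++ zipWith halfDiff s d)    ≡⟨ pairSums-++ (zipWith halfSum s d) (zipWith halfDiff s d) ⟩
      zipWith _+_ (zipWith halfSum s d) (zipWith halfDiff s d)  ≡⟨ sums-of-halves s d ps pd ⟩
      s                                                         ∎)) (allSameParity-intro t s ps)
      where open ≡-Reasoning

    sumSq-rotate-++ : ∀ (u v : Vec ℤ n) → sumSq (rotate (u ++ v)) ≡ 2 ℕ.* sumSq (u ++ v)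
    sumSq-rotate-++ u v = begin
      sumSq (rotate (u ++ v))                                  ≡⟨ cong sumSq (pairwise-++ _+_ _-_ u v) ⟩
      sumSq (zipWith _+_ u v ++ zipWith _-_ u v)               ≡⟨ sumSq-++ (zipWith _+_ u v) (zipWith _-_ u v) ⟩
      sumSq (zipWith _+_ u v) ℕ.+ sumSq (zipWith _-_ u v)      ≡⟨ sumSq-rotate u v ⟩
      2 ℕ.* (sumSq u ℕ.+ sumSq v)                              ≡⟨ cong (2 ℕ.*_) (sumSq-++ u v) ⟨
      2 ℕ.* sumSq (u ++ v)                                     ∎
      where open ≡-Reasoning

    unrotate∘rotate : ∀ (u v : Vec ℤ n) → unrotate (rotate (u ++ v)) ≡ u ++ v
    unrotate∘rotate u v = begin
      unrotate (rotate (u ++ v))                            ≡⟨ cong unrotate (pairwise-++ _+_ _-_ u v) ⟩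
      unrotate (zipWith _+_ u v ++ zipWith _-_ u v)         ≡⟨ pairwise-++ halfSum halfDiff (zipWith _+_ u v) (zipWith _-_ u v) ⟩
      zipWith halfSum (zipWith _+_ u v) (zipWith _-_ u v) ++ zipWith halfDiff (zipWith _+_ u v) (zipWith _-_ u v)
                                                            ≡⟨ cong₂ _++_ (halfSums-rotated u v) (halfDiffs-rotated u v) ⟩
      u ++ v                                                ∎
      where open ≡-Reasoning

    rotate∘unrotate : ∀ (s d : Vec ℤ n) → T (allSameParity (s ++ d)) → rotate (unrotate (s ++ d)) ≡ s ++ d
    rotate∘unrotate s d p with halves-have-parity s d p
    ... | t , ps , pd = begin
      rotate (unrotate (s ++ d))                            ≡⟨ cong rotate (pairwise-++ halfSum halfDiff s d) ⟩
      rotate (zipWith halfSum s d ++ zipWith halfDiff s d)  ≡⟨ pairwise-++ _+_ _-_ (zipWith halfSum s d) (zipWith halfDiff s d) ⟩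
      zipWith _+_ (zipWith halfSum s d) (zipWith halfDiff s d) ++ zipWith _-_ (zipWith halfSum s d) (zipWith halfDiff s d)
                                                            ≡⟨ cong₂ _++_ (sums-of-halves s d ps pd) (diffs-of-halves s d ps pd) ⟩
      s ++ d                                                ∎
      where open ≡-Reasoning

  rotation : ∀ {n} → Isometry (λ y → allSameParity (pairSums {n} y)) (λ y → 2 ℕ.* sumSq y) allSameParity sumSq
  rotation {n} = record
    { to       = rotate {n}
    ; from     = unrotate {n}
    ; to-mem   = λ {y} → by-halves {n = n} (λ y → SameParityPairs {n} y → T (allSameParity (rotate {n} y))) rotate-sameParity y
    ; from-mem = λ {x} → by-halves {n = n} (λ x → T (allSameParity x) → SameParityPairs {n} (unrotate {n} x)) unrotate-sameParity x
    ; to-norm  = λ {y} → by-halves {n = n} (λ y → SameParityPairs {n} y → sumSq (rotate {n} y) ≡ 2 ℕ.* sumSq y) (λ u v _ → sumSq-rotate-++ u v) y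
    ; from-to  = λ {y} → by-halves {n = n} (λ y → SameParityPairs {n} y → unrotate {n} (rotate {n} y) ≡ y) (λ u v _ → unrotate∘rotate u v) y
    ; to-from  = λ {x} → by-halves {n = n} (λ x → T (allSameParity x) → rotate {n} (unrotate {n} x) ≡ x) rotate∘unrotate x
    }

module Supports where
  open import Data.Bool using (true; false; _∧_; not; if_then_else_)
  open import Data.Nat using (ℕ; zero; suc; _+_; _*_)
  import Data.Nat.Properties as ℕP
  open import Algebra.Properties.CommutativeMonoid.Sum ℕP.+-0-commutativeMonoid
    using (sum; sum-syntax; ∑-comm; ∑-distrib-+; sum-cong-≗; sum-replicate-zero)
  open import Algebra.Properties.CommutativeSemigroup ℕP.+-commutativeSemigroup using (x∙yz≈y∙xz)
  open import Data.Integer using (ℤ)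
  open import Data.Fin as Fin using (Fin; zero; suc)
  open import Data.Vec using (Vec; []; _∷_; lookup; zipWith; _[_]≔_)
  import Data.Vec.Properties as VecP
  open import Data.Sum using (_⊎_; inj₁; inj₂)
  open import Data.Product using (∃; _,_)
  open import Relation.Nullary using (yes; no; does)
  open import Relation.Binary.PropositionalEquality
  open import Function using (_∘_)

  sumOn : ∀ {n} → Word n → (Fin n → ℕ) → ℕ
  sumOn {n} w h = ∑[ i < n ] (if lookup w i then h i else 0)

  weight≡sumOn : ∀ {n} (w : Word n) → weight w ≡ sumOn w (λ _ → 1)
  weight≡sumOn []          = refl
  weight≡sumOn (true  ∷ w) = cong suc (weight≡sumOn w)
  weight≡sumOn (false ∷ w) = weight≡sumOn w

  sumOn-zeroWord : ∀ {n} (h : Fin n → ℕ) → sumOn zeroWord h ≡ 0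
  sumOn-zeroWord {zero}  h = refl
  sumOn-zeroWord {suc n} h = sumOn-zeroWord (λ i → h (suc i))

  sumOn-clear : ∀ {n} (w : Word n) x (h : Fin n → ℕ) → lookup w x ≡ true → sumOn w h ≡ h x + sumOn (w [ x ]≔ false) h
  sumOn-clear (true ∷ w) zero    h refl = refl
  sumOn-clear (b    ∷ w) (suc x) h w[x] = begin
    (if b then h zero else 0) + sumOn w (λ i → h (suc i))
      ≡⟨ cong ((if b then h zero else 0) +_) (sumOn-clear w x (λ i → h (suc i)) w[x]) ⟩
    (if b then h zero else 0) + (h (suc x) + sumOn (w [ x ]≔ false) (λ i → h (suc i)))
      ≡⟨ x∙yz≈y∙xz (if b then h zero else 0) (h (suc x)) _ ⟩
    h (suc x) + ((if b then h zero else 0) + sumOn (w [ x ]≔ false) (λ i → h (suc i)))  ∎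
    where open ≡-Reasoning

  weight-zero : ∀ {n} (w : Word n) → weight w ≡ 0 → w ≡ zeroWord
  weight-zero []          _ = refl
  weight-zero (false ∷ w) e = cong (false ∷_) (weight-zero w e)

  module _ {n} (w : Word n) {x y : Fin n} (x≢y : x ≢ y) (w[x] : lookup w x ≡ true) (w[y] : lookup w y ≡ true) where

    private
      w′ : Word n
      w′ = w [ x ]≔ false

      w′[y] : lookup w′ y ≡ true
      w′[y] = trans (VecP.lookup∘update′ (x≢y ∘ sym) w false) w[y]

    weight-2⇒cleared : weight w ≡ 2 → w′ [ y ]≔ false ≡ zeroWord
    weight-2⇒cleared w2 = weight-zero (w′ [ y ]≔ false) (ℕP.suc-injective (ℕP.suc-injective (begin
      2 + weight (w′ [ y ]≔ false)                        ≡⟨ cong (2 +_) (weight≡sumOn (w′ [ y ]≔ false)) ⟩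
      1 + (1 + sumOn (w′ [ y ]≔ false) (λ _ → 1))          ≡⟨ cong suc (sym (sumOn-clear w′ y _ w′[y])) ⟩
      1 + sumOn w′ (λ _ → 1)                              ≡⟨ sym (sumOn-clear w x _ w[x]) ⟩
      sumOn w (λ _ → 1)                                   ≡⟨ sym (weight≡sumOn w) ⟩
      weight w                                            ≡⟨ w2 ⟩
      2                                                   ∎)))
      where open ≡-Reasoning

    weight-2⇒support : weight w ≡ 2 → ∀ z → lookup w z ≡ true → z ≡ x ⊎ z ≡ y
    weight-2⇒support w2 z w[z] with z Fin.≟ x | z Fin.≟ y
    ... | yes z≡x | _       = inj₁ z≡x
    ... | no _    | yes z≡y = inj₂ z≡y
    ... | no z≢x  | no z≢y  with trans (sym (trans (VecP.lookup∘update′ (z≢y) w′ false) (trans (VecP.lookup∘update′ z≢x w false) w[z])))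
                                       (trans (cong (λ v → lookup v z) (weight-2⇒cleared w2)) (VecP.lookup-replicate z false))
    ...   | ()

    weight-2⇒sumOn : weight w ≡ 2 → ∀ h → sumOn w h ≡ h x + h y
    weight-2⇒sumOn w2 h = begin
      sumOn w h                                       ≡⟨ sumOn-clear w x h w[x] ⟩
      h x + sumOn w′ h                                ≡⟨ cong (h x +_) (sumOn-clear w′ y h w′[y]) ⟩
      h x + (h y + sumOn (w′ [ y ]≔ false) h)         ≡⟨ cong (λ v → h x + (h y + sumOn v h)) (weight-2⇒cleared w2) ⟩
      h x + (h y + sumOn zeroWord h)                  ≡⟨ cong (λ s → h x + (h y + s)) (sumOn-zeroWord h) ⟩
      h x + (h y + 0)                                 ≡⟨ cong (h x +_) (ℕP.+-identityʳ (h y)) ⟩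
      h x + h y                                       ∎
      where open ≡-Reasoning

  _∖_ : ∀ {n} → Word n → Word n → Word n
  w ∖ u = zipWith (λ a b → a ∧ not b) w u

  sumOn-∩-∖ : ∀ {n} (u w : Word n) h → sumOn (u ∩ w) h + sumOn (w ∖ u) h ≡ sumOn w h
  sumOn-∩-∖ u w h = trans (sym (∑-distrib-+ (λ i → if lookup (u ∩ w) i then h i else 0) (λ i → if lookup (w ∖ u) i then h i else 0))) (sum-cong-≗ pointwise)
    where
    pointwise : ∀ i → (if lookup (u ∩ w) i then h i else 0) + (if lookup (w ∖ u) i then h i else 0)
                    ≡ (if lookup w i then h i else 0)
    pointwise i rewrite VecP.lookup-zipWith _∧_ i u w | VecP.lookup-zipWith (λ a b → a ∧ not b) i w u
      with lookup u i | lookup w i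
    ... | true  | true  = ℕP.+-identityʳ (h i)
    ... | true  | false = refl
    ... | false | true  = refl
    ... | false | false = refl

  ∑-select : ∀ {k} (a : Fin k) c → ∑[ j < k ] (if does (a Fin.≟ j) then c else 0) ≡ c
  ∑-select {suc k} zero    c = trans (cong (c +_) (sum-replicate-zero k)) (ℕP.+-identityʳ c)
  ∑-select {suc k} (suc a) c = ∑-select {k} a c

  sum-partition : ∀ {n k} (blk : Fin n → Fin k) (W : Fin k → Word n)
    → (∀ j i → lookup (W j) i ≡ does (blk i Fin.≟ j)) → ∀ h → sum h ≡ ∑[ j < k ] sumOn (W j) h
  sum-partition {n} {k} blk W W≡fibre h = begin
    ∑[ i < n ] h i                                                    ≡⟨ sum-cong-≗ (λ i → sym (∑-select (blk i) (h i))) ⟩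
    ∑[ i < n ] ∑[ j < k ] (if does (blk i Fin.≟ j) then h i else 0)      ≡⟨ ∑-comm (λ i j → if does (blk i Fin.≟ j) then h i else 0) ⟩
    ∑[ j < k ] ∑[ i < n ] (if does (blk i Fin.≟ j) then h i else 0)      ≡⟨ sum-cong-≗ (λ j → sum-cong-≗ (λ i →
                                                                           cong (if_then h i else 0) (sym (W≡fibre j i)))) ⟩
    ∑[ j < k ] sumOn (W j) h                                          ∎
    where open ≡-Reasoning

  weight-suc⇒support : ∀ {n m} (w : Word n) → weight w ≡ suc m → ∃ λ i → lookup w i ≡ true
  weight-suc⇒support (true  ∷ w) _ = zero , refl
  weight-suc⇒support (false ∷ w) e with weight-suc⇒support w e
  ... | i , w[i] = suc i , w[i]

  ∑-const : ∀ n c → ∑[ i < n ] c ≡ n * c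
  ∑-const zero    c = refl
  ∑-const (suc n) c = cong (c +_) (∑-const n c)

  sumSq≡∑ : ∀ {n} (y : Vec ℤ n) → sumSq y ≡ ∑[ i < n ] sq (lookup y i)
  sumSq≡∑ []      = refl
  sumSq≡∑ (z ∷ y) = cong (sq z +_) (sumSq≡∑ y)



module CodeFacts where
  open import Data.Bool using (Bool; true; false; _∧_; _xor_; not)
  open import Data.Bool.Properties using (∧-identityʳ)
  open import Data.Nat as ℕ using (ℕ; zero; suc; _+_; _*_; _%_; _/_)
  import Data.Nat.Properties as ℕP
  import Data.Nat.DivMod as ℕDM
  open import Data.Fin as Fin using (Fin; zero; suc)
  open import Data.Fin.Permutation using (Permutation′; _⟨$⟩ʳ_; _⟨$⟩ˡ_; inverseˡ; inverseʳ)
  open import Data.Vec using (Vec; []; _∷_; lookup; replicate; map; zipWith)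
  import Data.Vec.Properties as VecP
  open import Data.Sum using (_⊎_)
  open import Relation.Nullary using (does; yes; no)
  open import Function using (_∘_)
  open import Relation.Binary.PropositionalEquality
  open Supports

  lookup-extensionality : ∀ {A : Set} {n} {w w′ : Vec A n} → (∀ x → lookup w x ≡ lookup w′ x) → w ≡ w′
  lookup-extensionality {w = w} {w′} pointwise =
    trans (sym (VecP.tabulate∘lookup w)) (trans (VecP.tabulate-cong pointwise) (VecP.tabulate∘lookup w′))

  module _ {A : Set} {n} (g : Permutation′ n) where

    lookup-act : ∀ (v : Vec A n) i → lookup (act g v) i ≡ lookup v (g ⟨$⟩ˡ i)
    lookup-act v i = VecP.lookup∘tabulate _ i

    fixed⇒invariant : ∀ {v : Vec A n} → act g v ≡ v → ∀ x → lookup v (g ⟨$⟩ʳ x) ≡ lookup v x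
    fixed⇒invariant {v} fixed x = begin
      lookup v (g ⟨$⟩ʳ x)                 ≡⟨ cong (λ w → lookup w (g ⟨$⟩ʳ x)) fixed ⟨
      lookup (act g v) (g ⟨$⟩ʳ x)         ≡⟨ lookup-act v (g ⟨$⟩ʳ x) ⟩
      lookup v (g ⟨$⟩ˡ (g ⟨$⟩ʳ x))        ≡⟨ cong (lookup v) (inverseˡ g) ⟩
      lookup v x                          ∎
      where open ≡-Reasoning

    invariant⇒fixed : ∀ {v : Vec A n} → (∀ x → lookup v (g ⟨$⟩ʳ x) ≡ lookup v x) → act g v ≡ v
    invariant⇒fixed {v} invariant = lookup-extensionality (λ i → begin
      lookup (act g v) i              ≡⟨ lookup-act v i ⟩
      lookup v (g ⟨$⟩ˡ i)             ≡⟨ invariant (g ⟨$⟩ˡ i) ⟨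
      lookup v (g ⟨$⟩ʳ (g ⟨$⟩ˡ i))    ≡⟨ cong (lookup v) (inverseʳ g) ⟩
      lookup v i                      ∎)
      where open ≡-Reasoning

  act-replicate : ∀ {A : Set} {n} (g : Permutation′ n) (x : A) → act g (replicate n x) ≡ replicate n x
  act-replicate g x = invariant⇒fixed g (λ i → trans (VecP.lookup-replicate (g ⟨$⟩ʳ i) x) (sym (VecP.lookup-replicate i x)))

  act-map : ∀ {A B : Set} {n} (g : Permutation′ n) (f : A → B) (v : Vec A n) → act g (map f v) ≡ map f (act g v)
  act-map g f v = trans (VecP.tabulate-cong (λ i → VecP.lookup-map _ f v)) (VecP.tabulate-∘ f _)

  oddᵇ : ℕ → Bool
  oddᵇ zero    = false
  oddᵇ (suc n) = not (oddᵇ n)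

  dot-allOnes : ∀ {n} (c : Word n) → dot (replicate n true) c ≡ oddᵇ (weight c)
  dot-allOnes []          = refl
  dot-allOnes (true  ∷ c) = cong not (dot-allOnes c)
  dot-allOnes (false ∷ c) = dot-allOnes c

  oddᵇ-*4 : ∀ q → oddᵇ (q * 4) ≡ false
  oddᵇ-*4 zero    = refl
  oddᵇ-*4 (suc q) rewrite oddᵇ-*4 q = refl

  allOnes∈C : ∀ {N} {C : Code N} → IsSelfDual C → IsDoublyEven C → replicate N true ∈C C
  allOnes∈C sd de = IsSelfDual.sup sd _ (λ c c∈C → trans (dot-allOnes c)
    (trans (cong oddᵇ (trans (ℕDM.m≡m%n+[m/n]*n (weight c) 4) (cong (_+ weight c / 4 * 4) (de c c∈C)))) (oddᵇ-*4 (weight c / 4))))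

  module _ {n} (g : Permutation′ n) (g-fpf : ∀ x → g ⟨$⟩ʳ x ≢ x)
           {w : Word n} (w-fixed : act g w ≡ w) (w2 : weight w ≡ 2) {x : Fin n} (w[x] : lookup w x ≡ true) where

    private
      w[gx] : lookup w (g ⟨$⟩ʳ x) ≡ true
      w[gx] = trans (fixed⇒invariant g w-fixed x) w[x]

      x≢gx : x ≢ g ⟨$⟩ʳ x
      x≢gx = g-fpf x ∘ sym

    fixed-pair-support : ∀ z → lookup w z ≡ true → z ≡ x ⊎ z ≡ g ⟨$⟩ʳ x
    fixed-pair-support = weight-2⇒support w x≢gx w[x] w[gx] w2

    fixed-pair-sumOn : ∀ h → sumOn w h ≡ h x + h (g ⟨$⟩ʳ x)
    fixed-pair-sumOn = weight-2⇒sumOn w x≢gx w[x] w[gx] w2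

  module _ {N : ℕ} where

    lookup-lincomb-∷ : ∀ {k} b (s : Vec Bool k) (W : Fin (suc k) → Word N) i
      → lookup (lincomb (b ∷ s) W) i ≡ (b ∧ lookup (W zero) i) xor lookup (lincomb s (W ∘ suc)) i
    lookup-lincomb-∷ true  s W i = VecP.lookup-zipWith _xor_ i (W zero) _
    lookup-lincomb-∷ false s W i = trans (VecP.lookup-zipWith _xor_ i zeroWord _)
                                         (cong (_xor lookup (lincomb s (W ∘ suc)) i) (VecP.lookup-replicate i false))

    lookup-lincomb-outside : ∀ {k} (s : Vec Bool k) (W : Fin k → Word N) i
      → (∀ l → lookup (W l) i ≡ false) → lookup (lincomb s W) i ≡ false
    lookup-lincomb-outside []      W i _       = VecP.lookup-replicate i false
    lookup-lincomb-outside (b ∷ s) W i outside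
      rewrite lookup-lincomb-∷ b s W i | outside zero | lookup-lincomb-outside s (W ∘ suc) i (outside ∘ suc)
      with b
    ... | true  = refl
    ... | false = refl

    lookup-lincomb-fibre : ∀ {k} (s : Vec Bool k) (W : Fin k → Word N) i a
      → (∀ l → lookup (W l) i ≡ does (a Fin.≟ l)) → lookup (lincomb s W) i ≡ lookup s a
    lookup-lincomb-fibre (b ∷ s) W i zero fibre
      rewrite lookup-lincomb-∷ b s W i | fibre zero | lookup-lincomb-outside s (W ∘ suc) i (fibre ∘ suc)
      with b
    ... | true  = refl
    ... | false = refl
    lookup-lincomb-fibre (b ∷ s) W i (suc a) fibre
      rewrite lookup-lincomb-∷ b s W i | fibre zero | lookup-lincomb-fibre s (W ∘ suc) i a (fibre ∘ suc)
      with b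
    ... | true  = refl
    ... | false = refl

    lincomb∈C : ∀ {C : Code N} → IsLinear C → ∀ {k} (s : Vec Bool k) (W : Fin k → Word N) → (∀ l → W l ∈C C) → lincomb s W ∈C C
    lincomb∈C lin []          W W∈C = IsLinear.zero∈ lin
    lincomb∈C lin (true  ∷ s) W W∈C = IsLinear.⊕∈ lin _ _ (W∈C zero) (lincomb∈C lin s (W ∘ suc) (W∈C ∘ suc))
    lincomb∈C lin (false ∷ s) W W∈C = IsLinear.⊕∈ lin _ _ (IsLinear.zero∈ lin) (lincomb∈C lin s (W ∘ suc) (W∈C ∘ suc))

    disjoint⇒fibre : ∀ {k} (W : Fin k → Word N) → (∀ i j → i ≢ j → W i ∩ W j ≡ zeroWord)
      → ∀ {j x} → lookup (W j) x ≡ true → ∀ l → lookup (W l) x ≡ does (j Fin.≟ l)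
    disjoint⇒fibre W disjoint {j} {x} W[x] l with j Fin.≟ l
    ... | yes refl = W[x]
    ... | no j≢l   = begin
      lookup (W l) x                    ≡⟨ sym (∧-identityʳ _) ⟩
      lookup (W l) x ∧ true             ≡⟨ cong (lookup (W l) x ∧_) W[x] ⟨
      lookup (W l) x ∧ lookup (W j) x   ≡⟨ VecP.lookup-zipWith _∧_ x (W l) (W j) ⟨
      lookup (W l ∩ W j) x              ≡⟨ cong (λ v → lookup v x) (disjoint l j (j≢l ∘ sym)) ⟩
      lookup zeroWord x                 ≡⟨ VecP.lookup-replicate x false ⟩
      false                             ∎
      where open ≡-Reasoning

  zipWith-fixed : ∀ {A B C : Set} {n} (g : Permutation′ n) (f : A → B → C) {u : Vec A n} {w : Vec B n}
    → act g u ≡ u → act g w ≡ w → act g (zipWith f u w) ≡ zipWith f u w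
  zipWith-fixed g f {u} {w} u-fixed w-fixed = invariant⇒fixed g (λ x → begin
    lookup (zipWith f u w) (g ⟨$⟩ʳ x)               ≡⟨ VecP.lookup-zipWith f (g ⟨$⟩ʳ x) u w ⟩
    f (lookup u (g ⟨$⟩ʳ x)) (lookup w (g ⟨$⟩ʳ x))   ≡⟨ cong₂ f (fixed⇒invariant g u-fixed x) (fixed⇒invariant g w-fixed x) ⟩
    f (lookup u x) (lookup w x)                     ≡⟨ VecP.lookup-zipWith f x u w ⟨
    lookup (zipWith f u w) x                        ∎)
    where open ≡-Reasoning

  lincomb-replicate-false : ∀ {N k} (W : Fin k → Word N) → lincomb (replicate k false) W ≡ zeroWord
  lincomb-replicate-false {k = zero}  W = refl
  lincomb-replicate-false {k = suc k} W =
    trans (cong (zeroWord ⊕_) (lincomb-replicate-false (W ∘ suc))) (VecP.zipWith-replicate _xor_ false false)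

  independent⇒nonzero : ∀ {N k} (B : Fin (suc k) → Word N)
    → (∀ s → lincomb s B ≡ zeroWord → s ≡ replicate (suc k) false) → B zero ≢ zeroWord
  independent⇒nonzero {k = k} B independent B₀≡0 with independent (true ∷ replicate k false)
    (trans (cong₂ _⊕_ B₀≡0 (lincomb-replicate-false (B ∘ suc))) (VecP.zipWith-replicate _xor_ false false))
  ... | ()

  nonzero-half-weight⇒N/4≢0 : ∀ {N} (w : Word N) → weight w ≡ N / 2 → weight w % 4 ≡ 0 → w ≢ zeroWord → N / 4 ≢ 0
  nonzero-half-weight⇒N/4≢0 {N} w w≡N/2 w%4 w≢0 N/4≡0 = w≢0 (weight-zero w (begin
    weight w       ≡⟨ ℕDM.m<n⇒m%n≡m w<4 ⟨
    weight w % 4   ≡⟨ w%4 ⟩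
    0              ∎))
    where
    open ≡-Reasoning
    N<4 : N ℕ.< 4
    N<4 = ℕDM.m/n≡0⇒m<n N/4≡0
    w<4 : weight w ℕ.< 4
    w<4 = ℕP.≤-<-trans (ℕP.≤-trans (ℕP.≤-reflexive w≡N/2) (ℕDM.m/n≤m N 2)) N<4


module FixedSublattice where
  open import Data.Bool using (Bool; true; false; T; _∧_; _xor_; not; if_then_else_)
  open import Data.Fin.Permutation using (Permutation′; _⟨$⟩ʳ_)
  open import Data.Bool.Properties using (T-≡; ∧-identityʳ; ∧-zeroʳ; ∧-conicalˡ; ∧-conicalʳ; not-injective)
  import Data.Bool
  open import Data.Nat using (ℕ; suc; _+_; _*_; _/_)
  import Data.Nat.Properties as ℕP
  import Data.Nat.DivMod as ℕDM
  import Data.Nat.Tactic.RingSolver as ℕSolver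
  open import Algebra.Properties.Semiring.Sum ℕP.+-*-semiring
    using (sum; sum-syntax; sum-cong-≗; ∑-distrib-+; *-distribˡ-sum)
  open import Data.Integer as ℤ using (ℤ)
  open import Data.Fin as Fin using (Fin; zero; suc)
  import Data.Fin.Properties as FinP
  open import Data.Vec using (Vec; _∷_; lookup; tabulate; replicate; map; zipWith; _++_; take; drop)
  import Data.Vec.Properties as VecP
  open import Data.Vec.Relation.Unary.All using (All)
  import Data.Vec.Relation.Unary.All.Properties as AllP
  open import Data.Product using (Σ; ∃; _,_; proj₁; proj₂)
  open import Data.Sum using (inj₁; inj₂)
  open import Data.Empty using (⊥; ⊥-elim)
  open import Function using (_∘_; Equivalence)
  open import Relation.Nullary using (does; yes; no)
  open import Relation.Nullary.Decidable using (toWitness; fromWitness)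
  open import Relation.Binary.PropositionalEquality
  open IntegerParity
  open LatticeCounting
  open DualLattice
  open PairLattice
  open Supports
  open CodeFacts

  module BlockFrame
    {N k : ℕ} {C : Code N} (C-linear : IsLinear C)
    (g : Permutation′ N) (g-fpf : ∀ x → g ⟨$⟩ʳ x ≢ x)
    (B : Fin (suc k) → Word N) (B∈C : ∀ l → B l ∈C C) (B-fixed : ∀ l → act g (B l) ≡ B l)
    (fixed-span : ∀ c → c ∈C C → act g c ≡ c → Σ (Vec Bool (suc k)) (λ s → c ≡ lincomb s B))
    (allOnes∈C : replicate N true ∈C C)
    (j₀ : Fin k)
    (weight-block : ∀ j → weight (B (suc j)) ≡ 4)
    (blocks-disjoint : ∀ i j → i ≢ j → B (suc i) ∩ B (suc j) ≡ zeroWord)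
    (weight-B₀∩block : ∀ j → weight (B zero ∩ B (suc j)) ≡ 2)
    where

    B₀ : Word N
    B₀ = B zero

    block : Fin k → Word N
    block j = B (suc j)

    inner outer : Fin k → Word N
    inner j = B₀ ∩ block j
    outer j = block j ∖ B₀

    gx : Fin N → Fin N
    gx x = g ⟨$⟩ʳ x

    weight-outer : ∀ j → weight (outer j) ≡ 2
    weight-outer j = ℕP.+-cancelˡ-≡ 2 _ _ (begin
      2 + weight (outer j)                                   ≡⟨ cong₂ _+_ (sym (weight-B₀∩block j)) refl ⟩
      weight (inner j) + weight (outer j)                    ≡⟨ cong₂ _+_ (weight≡sumOn (inner j)) (weight≡sumOn (outer j)) ⟩
      sumOn (inner j) (λ _ → 1) + sumOn (outer j) (λ _ → 1)  ≡⟨ sumOn-∩-∖ B₀ (block j) (λ _ → 1) ⟩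
      sumOn (block j) (λ _ → 1)                              ≡⟨ sym (weight≡sumOn (block j)) ⟩
      weight (block j)                                       ≡⟨ weight-block j ⟩
      4                                                      ∎)
      where open ≡-Reasoning

    inner-fixed : ∀ j → act g (inner j) ≡ inner j
    inner-fixed j = zipWith-fixed g _∧_ (B-fixed zero) (B-fixed (suc j))

    outer-fixed : ∀ j → act g (outer j) ≡ outer j
    outer-fixed j = zipWith-fixed g _ (B-fixed (suc j)) (B-fixed zero)

    p q : Fin k → Fin N
    p j = proj₁ (weight-suc⇒support (inner j) (weight-B₀∩block j))
    q j = proj₁ (weight-suc⇒support (outer j) (weight-outer j))

    p∈inner : ∀ j → lookup (inner j) (p j) ≡ true
    p∈inner j = proj₂ (weight-suc⇒support (inner j) (weight-B₀∩block j))

    q∈outer : ∀ j → lookup (outer j) (q j) ≡ true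
    q∈outer j = proj₂ (weight-suc⇒support (outer j) (weight-outer j))

    inner⇔ : ∀ j x → lookup (inner j) x ≡ lookup B₀ x ∧ lookup (block j) x
    inner⇔ j x = VecP.lookup-zipWith _∧_ x B₀ (block j)

    outer⇔ : ∀ j x → lookup (outer j) x ≡ lookup (block j) x ∧ not (lookup B₀ x)
    outer⇔ j x = VecP.lookup-zipWith _ x (block j) B₀

    B₀[p] : ∀ j → lookup B₀ (p j) ≡ true
    B₀[p] j = ∧-conicalˡ _ _ (trans (sym (inner⇔ j (p j))) (p∈inner j))

    block[p] : ∀ j → lookup (block j) (p j) ≡ true
    block[p] j = ∧-conicalʳ _ _ (trans (sym (inner⇔ j (p j))) (p∈inner j))

    B₀[q] : ∀ j → lookup B₀ (q j) ≡ false
    B₀[q] j = not-injective (∧-conicalʳ _ _ (trans (sym (outer⇔ j (q j))) (q∈outer j)))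

    block[q] : ∀ j → lookup (block j) (q j) ≡ true
    block[q] j = ∧-conicalˡ _ _ (trans (sym (outer⇔ j (q j))) (q∈outer j))

    in-block⇒fibre : ∀ {j x} → lookup (block j) x ≡ true → ∀ l → lookup (block l) x ≡ does (j Fin.≟ l)
    in-block⇒fibre = disjoint⇒fibre block blocks-disjoint

    lookup-lincomb-in-block : ∀ s₀ s {j x} → lookup (block j) x ≡ true
      → lookup (lincomb (s₀ ∷ s) B) x ≡ (s₀ ∧ lookup B₀ x) xor lookup s j
    lookup-lincomb-in-block s₀ s {j} {x} x∈block =
      trans (lookup-lincomb-∷ s₀ s B x) (cong ((s₀ ∧ lookup B₀ x) xor_) (lookup-lincomb-fibre s block x j (in-block⇒fibre x∈block)))

    -- Expand the all-ones word as Σ sᵢ Bᵢ: at q j₀ it gives s_{j₀} = 1, then at p j₀ it gives s₀ = 0,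
    -- so a coordinate outside every block would carry 0.
    blocks-cover : ∀ x → ∃ λ j → lookup (block j) x ≡ true
    blocks-cover x with FinP.any? (λ j → lookup (block j) x Data.Bool.≟ true)
    ... | yes found = found
    ... | no none with fixed-span (replicate N true) allOnes∈C (act-replicate g true)
    ...   | s₀ ∷ s , ones≡ = ⊥-elim (impossible s₀ (lookup s j₀) (lookup B₀ x)
        (trans (one-at (p j₀)) (trans (lookup-lincomb-in-block s₀ s (block[p] j₀)) (cong (λ b → (s₀ ∧ b) xor lookup s j₀) (B₀[p] j₀))))
        (trans (one-at (q j₀)) (trans (lookup-lincomb-in-block s₀ s (block[q] j₀)) (cong (λ b → (s₀ ∧ b) xor lookup s j₀) (B₀[q] j₀))))
        (trans (one-at x) (trans (lookup-lincomb-∷ s₀ s B x)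
          (cong ((s₀ ∧ lookup B₀ x) xor_) (lookup-lincomb-outside s block x outside)))))
      where
      one-at : ∀ z → true ≡ lookup (lincomb (s₀ ∷ s) B) z
      one-at z = trans (sym (VecP.lookup-replicate z true)) (cong (λ v → lookup v z) ones≡)
      outside : ∀ l → lookup (block l) x ≡ false
      outside l with lookup (block l) x in e
      ... | true  = ⊥-elim (none (l , e))
      ... | false = refl
      impossible : ∀ s₀ t b → true ≡ (s₀ ∧ true) xor t → true ≡ (s₀ ∧ false) xor t → true ≡ (s₀ ∧ b) xor false → ⊥
      impossible true  true  _ () _ _
      impossible true  false _ _ () _
      impossible false _     _ _ _ ()

    blk : Fin N → Fin k
    blk x = proj₁ (blocks-cover x)

    block[blk] : ∀ x → lookup (block (blk x)) x ≡ true
    block[blk] x = proj₂ (blocks-cover x)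

    block-fibre : ∀ l x → lookup (block l) x ≡ does (blk x Fin.≟ l)
    block-fibre l x = in-block⇒fibre (block[blk] x) l

    blk-unique : ∀ {j x} → lookup (block j) x ≡ true → blk x ≡ j
    blk-unique {j} {x} x∈block with blk x Fin.≟ j in eq
    ... | yes blk≡j = blk≡j
    ... | no _      with trans (sym x∈block) (trans (block-fibre j x) (cong does eq))
    ...   | ()

    B₀-invariant : ∀ x → lookup B₀ (gx x) ≡ lookup B₀ x
    B₀-invariant = fixed⇒invariant g (B-fixed zero)

    blk-invariant : ∀ x → blk (gx x) ≡ blk x
    blk-invariant x = blk-unique (trans (fixed⇒invariant g (B-fixed (suc (blk x))) x) (block[blk] x))

    blk-p : ∀ j → blk (p j) ≡ j
    blk-p j = blk-unique (block[p] j)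

    blk-q : ∀ j → blk (q j) ≡ j
    blk-q j = blk-unique (block[q] j)

    sum-blocks : ∀ h → sum h ≡ ∑[ j < k ] ((h (p j) + h (gx (p j))) + (h (q j) + h (gx (q j))))
    sum-blocks h = begin
      sum h                                                    ≡⟨ sum-partition blk block block-fibre h ⟩
      ∑[ j < k ] sumOn (block j) h                             ≡⟨ sum-cong-≗ (λ j → sumOn-∩-∖ B₀ (block j) h) ⟨
      ∑[ j < k ] (sumOn (inner j) h + sumOn (outer j) h)       ≡⟨ sum-cong-≗ (λ j → cong₂ _+_
          (fixed-pair-sumOn g g-fpf (inner-fixed j) (weight-B₀∩block j) (p∈inner j) h)
          (fixed-pair-sumOn g g-fpf (outer-fixed j) (weight-outer j) (q∈outer j) h)) ⟩
      ∑[ j < k ] ((h (p j) + h (gx (p j))) + (h (q j) + h (gx (q j))))  ∎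
      where open ≡-Reasoning

    N≡k*4 : N ≡ k * 4
    N≡k*4 = begin
      N                                 ≡⟨ ℕP.*-identityʳ N ⟨
      N * 1                             ≡⟨ ∑-const N 1 ⟨
      ∑[ x < N ] 1                      ≡⟨ sum-partition blk block block-fibre (λ _ → 1) ⟩
      ∑[ j < k ] sumOn (block j) (λ _ → 1)   ≡⟨ sum-cong-≗ (λ j → trans (sym (weight≡sumOn (block j))) (weight-block j)) ⟩
      ∑[ j < k ] 4                      ≡⟨ ∑-const k 4 ⟩
      k * 4                             ∎
      where open ≡-Reasoning

    spread : Vec ℤ k → Vec ℤ k → Vec ℤ N
    spread u v = tabulate (λ x → if lookup B₀ x then lookup u (blk x) else lookup v (blk x))

    at : (Fin k → Fin N) → Vec ℤ N → Vec ℤ k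
    at f a = tabulate (lookup a ∘ f)

    restrict : Vec ℤ N → Vec ℤ (k + k)
    restrict a = at p a ++ at q a

    lookup-spread : ∀ u v x → lookup (spread u v) x ≡ (if lookup B₀ x then lookup u (blk x) else lookup v (blk x))
    lookup-spread u v x = VecP.lookup∘tabulate _ x

    spread-fixed : ∀ u v → act g (spread u v) ≡ spread u v
    spread-fixed u v = invariant⇒fixed g (λ x → begin
      lookup (spread u v) (gx x)     ≡⟨ lookup-spread u v (gx x) ⟩
      (if lookup B₀ (gx x) then lookup u (blk (gx x)) else lookup v (blk (gx x)))
                                     ≡⟨ cong₂ (λ b j → if b then lookup u j else lookup v j) (B₀-invariant x) (blk-invariant x) ⟩
      (if lookup B₀ x then lookup u (blk x) else lookup v (blk x))
                                     ≡⟨ lookup-spread u v x ⟨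
      lookup (spread u v) x          ∎)
      where open ≡-Reasoning

    spread-at-p : ∀ u v j → lookup (spread u v) (p j) ≡ lookup u j
    spread-at-p u v j = trans (lookup-spread u v (p j))
      (cong₂ (λ b i → if b then lookup u i else lookup v i) (B₀[p] j) (blk-p j))

    spread-at-q : ∀ u v j → lookup (spread u v) (q j) ≡ lookup v j
    spread-at-q u v j = trans (lookup-spread u v (q j))
      (cong₂ (λ b i → if b then lookup u i else lookup v i) (B₀[q] j) (blk-q j))

    spread-invariant : ∀ u v x → lookup (spread u v) (gx x) ≡ lookup (spread u v) x
    spread-invariant u v = fixed⇒invariant g (spread-fixed u v)

    restrict-spread : ∀ u v → restrict (spread u v) ≡ u ++ v
    restrict-spread u v = cong₂ _++_
      (trans (VecP.tabulate-cong (spread-at-p u v)) (VecP.tabulate∘lookup u))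
      (trans (VecP.tabulate-cong (spread-at-q u v)) (VecP.tabulate∘lookup v))

    spread-restrict : ∀ a → act g a ≡ a → spread (at p a) (at q a) ≡ a
    spread-restrict a a-fixed = trans (VecP.tabulate-cong pointwise) (VecP.tabulate∘lookup a)
      where
      representative : ∀ {w} {y} → act g w ≡ w → weight w ≡ 2 → lookup w y ≡ true
        → ∀ x → lookup w x ≡ true → lookup a y ≡ lookup a x
      representative w-fixed w2 w[y] x w[x] with fixed-pair-support g g-fpf w-fixed w2 w[y] x w[x]
      ... | inj₁ refl = refl
      ... | inj₂ refl = sym (fixed⇒invariant g a-fixed _)
      pointwise : ∀ x → (if lookup B₀ x then lookup (at p a) (blk x) else lookup (at q a) (blk x))
                      ≡ lookup a x
      pointwise x rewrite VecP.lookup∘tabulate (lookup a ∘ p) (blk x) | VecP.lookup∘tabulate (lookup a ∘ q) (blk x)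
        with lookup B₀ x in B₀[x]
      ... | true  = representative (inner-fixed (blk x)) (weight-B₀∩block (blk x)) (p∈inner (blk x)) x
                      (trans (inner⇔ (blk x) x) (cong₂ _∧_ B₀[x] (block[blk] x)))
      ... | false = representative (outer-fixed (blk x)) (weight-outer (blk x)) (q∈outer (blk x)) x
                      (trans (outer⇔ (blk x) x) (cong₂ (λ b c → b ∧ not c) (block[blk] x) B₀[x]))

    sumSq-spread : ∀ u v → sumSq (spread u v) ≡ 2 * sumSq (u ++ v)
    sumSq-spread u v = begin
      sumSq (spread u v)
        ≡⟨ sumSq≡∑ (spread u v) ⟩
      ∑[ x < N ] sq (lookup (spread u v) x)
        ≡⟨ sum-blocks (λ x → sq (lookup (spread u v) x)) ⟩
      ∑[ j < k ] ((s (p j) + s (gx (p j))) + (s (q j) + s (gx (q j))))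
        ≡⟨ sum-cong-≗ (λ j → cong₂ _+_ (pair (p j) (spread-at-p u v j)) (pair (q j) (spread-at-q u v j))) ⟩
      ∑[ j < k ] ((sq (lookup u j) + sq (lookup u j)) + (sq (lookup v j) + sq (lookup v j)))
        ≡⟨ sum-cong-≗ (λ j → regroup (sq (lookup u j)) (sq (lookup v j))) ⟩
      ∑[ j < k ] (2 * (sq (lookup u j) + sq (lookup v j)))
        ≡⟨ *-distribˡ-sum 2 (λ j → sq (lookup u j) + sq (lookup v j)) ⟨
      2 * ∑[ j < k ] (sq (lookup u j) + sq (lookup v j))
        ≡⟨ cong (2 *_) (∑-distrib-+ (λ j → sq (lookup u j)) (λ j → sq (lookup v j))) ⟩
      2 * (∑[ j < k ] sq (lookup u j) + ∑[ j < k ] sq (lookup v j))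
        ≡⟨ cong (2 *_) (cong₂ _+_ (sumSq≡∑ u) (sumSq≡∑ v)) ⟨
      2 * (sumSq u + sumSq v)
        ≡⟨ cong (2 *_) (sumSq-++ u v) ⟨
      2 * sumSq (u ++ v)  ∎
      where
      open ≡-Reasoning
      s : Fin N → ℕ
      s x = sq (lookup (spread u v) x)
      pair : ∀ x {z} → lookup (spread u v) x ≡ z → s x + s (gx x) ≡ sq z + sq z
      pair x refl = cong (s x +_) (cong sq (spread-invariant u v x))
      regroup : ∀ a b → (a + a) + (b + b) ≡ 2 * (a + b)
      regroup = ℕSolver.solve-∀

    spread-mod2 : ∀ {t} u v → All (HasParity t) (zipWith ℤ._+_ u v) → map isOdd (spread u v) ≡ lincomb (t ∷ map isOdd v) B
    spread-mod2 {t} u v sums-parity = lookup-extensionality λ x → begin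
      lookup (map isOdd (spread u v)) x                        ≡⟨ VecP.lookup-map x isOdd (spread u v) ⟩
      isOdd (lookup (spread u v) x)                            ≡⟨ cong isOdd (lookup-spread u v x) ⟩
      isOdd (if lookup B₀ x then lookup u (blk x) else lookup v (blk x))
                                                               ≡⟨ by-B₀ (lookup B₀ x) (blk x) ⟩
      (t ∧ lookup B₀ x) xor isOdd (lookup v (blk x))           ≡⟨ cong ((t ∧ lookup B₀ x) xor_) (VecP.lookup-map (blk x) isOdd v) ⟨
      (t ∧ lookup B₀ x) xor lookup (map isOdd v) (blk x)       ≡⟨ lookup-lincomb-in-block t (map isOdd v) (block[blk] x) ⟨
      lookup (lincomb (t ∷ map isOdd v) B) x                   ∎
      where
      open ≡-Reasoning
      odd-u : ∀ j → isOdd (lookup u j) ≡ t xor isOdd (lookup v j)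
      odd-u j = xor-solve (trans (sym (isOdd-+ (lookup u j) (lookup v j)))
                            (trans (cong isOdd (sym (VecP.lookup-zipWith ℤ._+_ j u v))) (AllP.lookup⁺ sums-parity j)))
        where
        xor-solve : ∀ {a b c} → a xor b ≡ c → a ≡ c xor b
        xor-solve {true}  {true}  refl = refl
        xor-solve {true}  {false} refl = refl
        xor-solve {false} {true}  refl = refl
        xor-solve {false} {false} refl = refl
      by-B₀ : ∀ b j → isOdd (if b then lookup u j else lookup v j) ≡ (t ∧ b) xor isOdd (lookup v j)
      by-B₀ true  j = trans (odd-u j) (cong (_xor isOdd (lookup v j)) (sym (∧-identityʳ t)))
      by-B₀ false j = cong (_xor isOdd (lookup v j)) (sym (∧-zeroʳ t))

    spread∈C⇒parity : ∀ u v → map isOdd (spread u v) ∈C C → Σ Bool λ t → All (HasParity t) (zipWith ℤ._+_ u v)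
    spread∈C⇒parity u v c∈C with fixed-span (map isOdd (spread u v)) c∈C
                                    (trans (act-map g isOdd (spread u v)) (cong (map isOdd) (spread-fixed u v)))
    ... | s₀ ∷ s , c≡ = s₀ , AllP.lookup⁻ λ j → begin
      isOdd (lookup (zipWith ℤ._+_ u v) j)                   ≡⟨ cong isOdd (VecP.lookup-zipWith ℤ._+_ j u v) ⟩
      isOdd (lookup u j ℤ.+ lookup v j)                      ≡⟨ isOdd-+ (lookup u j) (lookup v j) ⟩
      isOdd (lookup u j) xor isOdd (lookup v j)              ≡⟨ cong₂ _xor_ (mod2-at (p j) (spread-at-p u v j) (block[p] j))
                                                                            (mod2-at (q j) (spread-at-q u v j) (block[q] j)) ⟩
      ((s₀ ∧ lookup B₀ (p j)) xor lookup s j) xor ((s₀ ∧ lookup B₀ (q j)) xor lookup s j)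
                                                             ≡⟨ cong₂ (λ b c → ((s₀ ∧ b) xor lookup s j) xor ((s₀ ∧ c) xor lookup s j)) (B₀[p] j) (B₀[q] j) ⟩
      ((s₀ ∧ true) xor lookup s j) xor ((s₀ ∧ false) xor lookup s j)
                                                             ≡⟨ cancel s₀ (lookup s j) ⟩
      s₀                                                     ∎
      where
      open ≡-Reasoning
      mod2-at : ∀ x {z} {j} → lookup (spread u v) x ≡ z → lookup (block j) x ≡ true
        → isOdd z ≡ (s₀ ∧ lookup B₀ x) xor lookup s j
      mod2-at x {j = j} refl x∈block = begin
        isOdd (lookup (spread u v) x)                ≡⟨ VecP.lookup-map x isOdd (spread u v) ⟨
        lookup (map isOdd (spread u v)) x            ≡⟨ cong (λ w → lookup w x) c≡ ⟩
        lookup (lincomb (s₀ ∷ s) B) x                ≡⟨ lookup-lincomb-in-block s₀ s x∈block ⟩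
        (s₀ ∧ lookup B₀ x) xor lookup s j            ∎
      cancel : ∀ a b → ((a ∧ true) xor b) xor ((a ∧ false) xor b) ≡ a
      cancel true  true  = refl
      cancel true  false = refl
      cancel false true  = refl
      cancel false false = refl

    -- Literally the membership test of θ-Lg, so thetaCoeff-isometry applies to θ-Lg as it stands.
    Lᵍ : Vec ℤ N → Bool
    Lᵍ a = C (map isOdd a) ∧ vecEqᵇ (act g a) a

    Lᵍ-fixed : ∀ {a} → T (Lᵍ a) → act g a ≡ a
    Lᵍ-fixed {a} m = toWitness {a? = VecP.≡-dec ℤ._≟_ (act g a) a} (∧-elimʳ (C (map isOdd a)) m)

    Lᵍ-mod2∈C : ∀ {a} → T (Lᵍ a) → map isOdd a ∈C C
    Lᵍ-mod2∈C {a} m = Equivalence.to T-≡ (∧-elimˡ (C (map isOdd a)) m)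

    Lᵍ-spread : ∀ {a} → T (Lᵍ a) → spread (at p a) (at q a) ≡ a
    Lᵍ-spread {a} m = spread-restrict a (Lᵍ-fixed m)

    unrestrict : Vec ℤ (k + k) → Vec ℤ N
    unrestrict y = spread (take k y) (drop k y)

    unrestrict-++ : ∀ u v → unrestrict (u ++ v) ≡ spread u v
    unrestrict-++ u v = cong₂ spread (take-++ k u v) (drop-++ k u v)

    restrict-sameParity : ∀ {a} → T (Lᵍ a) → SameParityPairs {k} (restrict a)
    restrict-sameParity {a} m
      with spread∈C⇒parity (at p a) (at q a) (subst (λ b → map isOdd b ∈C C) (sym (Lᵍ-spread m)) (Lᵍ-mod2∈C m))
    ... | t , sums-parity = subst (T ∘ allSameParity) (sym (pairSums-++ (at p a) (at q a)))
                                  (allSameParity-intro t (zipWith ℤ._+_ (at p a) (at q a)) sums-parity)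

    spread∈Lᵍ : ∀ u v → SameParityPairs {k} (u ++ v) → T (Lᵍ (spread u v))
    spread∈Lᵍ u v m with allSameParity-elim (zipWith ℤ._+_ u v) (subst (T ∘ allSameParity) (pairSums-++ u v) m)
    ... | t , sums-parity = ∧-intro (C (map isOdd (spread u v)))
      (Equivalence.from T-≡ (subst (_∈C C) (sym (spread-mod2 u v sums-parity)) (lincomb∈C C-linear (t ∷ map isOdd v) B B∈C)))
      (fromWitness (spread-fixed u v))

    restriction : Isometry Lᵍ sumSq (λ y → allSameParity (pairSums {k} y)) (λ y → 2 * sumSq y)
    restriction = record
      { to       = restrict
      ; from     = unrestrict
      ; to-mem   = restrict-sameParity
      ; from-mem = λ {y} → by-halves {n = k} (λ y → SameParityPairs {k} y → T (Lᵍ (unrestrict y)))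
                                     (λ u v m → subst (T ∘ Lᵍ) (sym (unrestrict-++ u v)) (spread∈Lᵍ u v m)) y
      ; to-norm  = λ {a} m → trans (sym (sumSq-spread (at p a) (at q a))) (cong sumSq (Lᵍ-spread m))
      ; from-to  = λ {a} m → trans (unrestrict-++ (at p a) (at q a)) (Lᵍ-spread m)
      ; to-from  = λ {y} → by-halves {n = k} (λ y → SameParityPairs {k} y → restrict (unrestrict y) ≡ y)
                                     (λ u v _ → trans (cong restrict (unrestrict-++ u v)) (restrict-spread u v)) y
      }

    N/2≡k+k : N / 2 ≡ k + k
    N/2≡k+k = begin
      N / 2          ≡⟨ cong (_/ 2) N≡k*4 ⟩
      k * 4 / 2      ≡⟨ cong (_/ 2) (ℕP.*-assoc k 2 2) ⟨
      k * 2 * 2 / 2  ≡⟨ ℕDM.m*n/n≡m (k * 2) 2 ⟩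
      k * 2          ≡⟨ ℕP.*-comm k 2 ⟩
      2 * k          ≡⟨ cong (k +_) (ℕP.+-identityʳ k) ⟩
      k + k          ∎
      where open ≡-Reasoning

    N/2≢0 : N / 2 ≢ 0
    N/2≢0 N/2≡0 = FinP.¬Fin0 (subst Fin (ℕP.m+n≡0⇒m≡0 k (trans (sym N/2≡k+k) N/2≡0)) j₀)

    θ-Lg≡θ-Dstar2 : ∀ m → θ-Lg C g m ≡ θ-Dstar2 (N / 2) m
    θ-Lg≡θ-Dstar2 m rewrite N/2≡k+k =
      trans (thetaCoeff-isometry sumSq-bounds doubled-bounds restriction m)
            (thetaCoeff-isometry doubled-bounds sumSq-bounds (rotation {k}) m)
      where
      doubled-bounds : CoordinatesBoundedBy (λ y → 2 * sumSq {k + k} y)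
      doubled-bounds = bounds-mono sumSq-bounds (λ y → ℕP.m≤n*m (sumSq y) 2)

open import Data.Nat using (ℕ; suc; _/_; _+_)
open import Data.Bool using (Bool; false)
open import Data.Fin using (Fin; zero; suc; fromℕ<)
open import Data.Fin.Permutation using (Permutation′)
open import Data.Vec using (Vec; replicate)
open import Data.Product using (Σ; _×_; _,_; proj₁; proj₂)
open import Relation.Binary.PropositionalEquality using (_≡_; _≢_; trans)
open import Data.Nat.Properties using (n≢0⇒n>0)
open import Function using (_∘_)
open CodeFacts using (allOnes∈C; independent⇒nonzero; nonzero-half-weight⇒N/4≢0)
open DualLattice using (θ-Dstar2-split)

proposition7p4 : (N : ℕ) (C : Code N) → IsLinear C → IsSelfDual C → IsDoublyEven C
    → (g : Permutation′ N) → IsAut C g → HasCycleType2 g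
    → (B : Fin (suc (N / 4)) → Word N)
    → (∀ i → (B i ∈C C) × (act g (B i) ≡ B i))
    → (∀ c → c ∈C C → act g c ≡ c → Σ (Vec Bool (suc (N / 4))) (λ s → c ≡ lincomb s B))
    → (∀ s → lincomb s B ≡ zeroWord → s ≡ replicate (suc (N / 4)) false)
    → weight (B zero) ≡ N / 2
    → (∀ j → weight (B (suc j)) ≡ 4)
    → (∀ i j → i ≢ j → (B (suc i) ∩ B (suc j)) ≡ zeroWord)
    → (∀ j → weight (B zero ∩ B (suc j)) ≡ 2)
    → (∀ m → θ-Lg C g m ≡ θ3q2pow (N / 2) m + θ2q2pow (N / 2) m)
      × (∀ m → θ-Lg C g m ≡ θ-Dstar2 (N / 2) m)
proposition7p4 N C lin sd de g _ ct B hB span independent w₀ w-block disjoint w-B₀∩block =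
  (λ m → trans (θ-Lg≡θ-Dstar2 m) (θ-Dstar2-split (N / 2) N/2≢0 m)) , θ-Lg≡θ-Dstar2
  where
  N/4≢0 : N / 4 ≢ 0
  N/4≢0 = nonzero-half-weight⇒N/4≢0 (B zero) w₀ (de (B zero) (proj₁ (hB zero))) (independent⇒nonzero B independent)

  open FixedSublattice.BlockFrame lin g (proj₂ ∘ ct) B (proj₁ ∘ hB) (proj₂ ∘ hB) span (allOnes∈C sd de)
                                  (fromℕ< (n≢0⇒n>0 N/4≢0)) w-block disjoint w-B₀∩block
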